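{- Let $k\ge 2$ and $0\le\epsilon\le k-1$ be integers. Let $A^{k,\epsilon}$ be the infinite lower-triangular integer matrix whose $(i,j)$ entry (for $i,j\ge 0$) is $\left|\mathcal{P}_{i+1,j+1}^{k,\epsilon}\right|$. Then $A^{k,\epsilon}$ is the proper Riordan array $\mathcal{R}\big(C_k(t)^{k-\epsilon},\, t\,C_k(t)^k\big)$; that is, for all $i,j\ge 0$, $$\left|\mathcal{P}_{i+1,j+1}^{k,\epsilon}\right| = [t^i]\, C_k(t)^{k-\epsilon}\big(t\,C_k(t)^k\big)^j.$$
   Context: Fix an integer $k\ge 2$. All lattice paths start at $(0,0)$ and use steps $E=(1,0)$ and $N=(0,1)$. For integers $n\ge 0$ and $0\le\epsilon\le (k-1)n$ and any integer $\delta$, let $\mathcal{P}_{n,\delta}^{k,\epsilon}$ denote the set of ordered pairs $(\gamma_1,\gamma_2)$ of such lattice paths satisfying: (1) $\gamma_2$ consists of exactly $(k-1)n$ steps, the first of which is an $E$ step; (2) $\gamma_1$ consists of exactly $(k-1)n-\epsilon$ steps, the first of which is an $N$ step whenever $\gamma_1$ has at least one step ($\gamma_1$ is the empty path when $\epsilon=(k-1)n$); (3) $\gamma_1$ and $\gamma_2$ have no common point other than $(0,0)$; (4) if $\gamma_1$ ends at $(x_1,y_1)$ and $\gamma_2$ ends at $(x_2,y_2)$, then $x_2-x_1=\delta$; (5) writing $\gamma_2=E N^{b_1} E N^{b_2}\cdots E N^{b_m}$ with $b_i\ge 0$, every $b_i$ satisfies $b_i\equiv k-2 \pmod{k-1}$.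 The $k$-Catalan (Fuss–Catalan) numbers are $C^k_n=\frac{1}{kn+1}\binom{kn+1}{n}$, with generating function $C_k(t)=\sum_{n\ge 0}C^k_n t^n$, which satisfies $C_k(t)=1+t\,C_k(t)^k$. For power series $d(t),h(t)$ with $d(0)\neq 0$, $h(0)=0$, $h'(0)\ne 0$, the proper Riordan array $\mathcal{R}(d(t),h(t))$ is the infinite lower-triangular matrix whose $(i,j)$ entry is $[t^i]\,d(t)h(t)^j$, where $[t^i]$ denotes the coefficient of $t^i$. -}

module Defs where

open import Data.Bool using (Bool; true; false; _∧_; _∨_; not; if_then_else_)
open import Data.Nat using (ℕ; zero; suc; _+_; _*_; _∸_; _/_; _≡ᵇ_)
import Data.Nat.Divisibility as ℕD
open import Data.Nat.Combinatorics using (_C_)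
open import Data.Integer as ℤ using (ℤ; +_; ∣_∣)
open import Data.List using (List; []; _∷_; _++_; length; filterᵇ; map; concatMap)
open import Data.Bool.ListAction using (and; or)
open import Data.Product using (_×_; _,_; proj₁; proj₂)
open import Relation.Nullary using (does)
open import Relation.Binary.PropositionalEquality using (_≡_)

data Step : Set where
  E N : Step

Path : Set
Path = List Step

Point : Set
Point = ℕ × ℕ

move : Point → Step → Point
move (x , y) E = (suc x , y)
move (x , y) N = (x , suc y)

pointsFrom : Point → Path → List Point
pointsFrom p []      = p ∷ []
pointsFrom p (s ∷ γ) = p ∷ pointsFrom (move p s) γ

points : Path → List Point
points = pointsFrom (0 , 0)

endFrom : Point → Path → Point
endFrom p []      = p
endFrom p (s ∷ γ) = endFrom (move p s) γ

endpoint : Path → Point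
endpoint = endFrom (0 , 0)

allPaths : ℕ → List Path
allPaths zero    = [] ∷ []
allPaths (suc L) = map (E ∷_) (allPaths L) ++ map (N ∷_) (allPaths L)

allᵇ anyᵇ : {A : Set} → (A → Bool) → List A → Bool
allᵇ p xs = and (map p xs)
anyᵇ p xs = or (map p xs)

_==ₚ_ : Point → Point → Bool
(x , y) ==ₚ (x' , y') = (x ≡ᵇ x') ∧ (y ≡ᵇ y')

memberₚ : Point → List Point → Bool
memberₚ p = anyᵇ (p ==ₚ_)

startsWithE : Path → Bool
startsWithE (E ∷ _) = true
startsWithE _       = false

startsWithNIfNonempty : Path → Bool
startsWithNIfNonempty []      = true
startsWithNIfNonempty (N ∷ _) = true
startsWithNIfNonempty (E ∷ _) = false

onlyOriginCommon : Path → Path → Bool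
onlyOriginCommon γ₁ γ₂ =
  allᵇ (λ p → (p ==ₚ (0 , 0)) ∨ not (memberₚ p (points γ₂))) (points γ₁)

xDiff : Path → Path → ℤ
xDiff γ₁ γ₂ = (+ proj₁ (endpoint γ₂)) ℤ.- (+ proj₁ (endpoint γ₁))

-- (5): writing γ = E N^{b₁} E N^{b₂} ⋯ E N^{bₘ}, the list [b₁,…,bₘ].
-- runs γ = (number of leading N's of γ , the N-run lengths after each E)
runs : Path → ℕ × List ℕ
runs []      = (0 , [])
runs (N ∷ γ) = (suc (proj₁ (runs γ)) , proj₂ (runs γ))
runs (E ∷ γ) = (0 , proj₁ (runs γ) ∷ proj₂ (runs γ))

blocks : Path → List ℕ
blocks γ = proj₂ (runs γ)

-- b ≡ a (mod m) for natural numbers, i.e. m ∣ (b - a) in ℤ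
-- (integer divisibility m ∣ z is, by definition, ∣m∣ ∣ ∣z∣ in ℕ)
congruentᵇ : ℕ → ℕ → ℕ → Bool
congruentᵇ b a m = does (m ℕD.∣? ∣ (+ b) ℤ.- (+ a) ∣)

blocksOK : ℕ → Path → Bool
blocksOK k γ = allᵇ (λ b → congruentᵇ b (k ∸ 2) (k ∸ 1)) (blocks γ)

inP : (k ε n : ℕ) (δ : ℤ) → Path → Path → Bool
inP k ε n δ γ₁ γ₂ =
  ((length γ₂ ≡ᵇ (k ∸ 1) * n) ∧ startsWithE γ₂)
  ∧ ((length γ₁ ≡ᵇ (k ∸ 1) * n ∸ ε) ∧ startsWithNIfNonempty γ₁)
  ∧ onlyOriginCommon γ₁ γ₂
  ∧ does (xDiff γ₁ γ₂ ℤ.≟ δ)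
  ∧ blocksOK k γ₂

cardP : (k ε n : ℕ) (δ : ℤ) → ℕ
cardP k ε n δ =
  length (filterᵇ (λ pr → inP k ε n δ (proj₁ pr) (proj₂ pr))
                 (concatMap (λ γ₁ → map (γ₁ ,_) (allPaths ((k ∸ 1) * n)))
                            (allPaths ((k ∸ 1) * n ∸ ε))))

PS : Set
PS = ℕ → ℕ

sumUpTo : ℕ → (ℕ → ℕ) → ℕ
sumUpTo zero    f = f 0
sumUpTo (suc n) f = sumUpTo n f + f (suc n)

_·_ : PS → PS → PS
(f · g) n = sumUpTo n (λ i → f i * g (n ∸ i))

one : PS
one zero    = 1
one (suc _) = 0

_^ₚ_ : PS → ℕ → PS
f ^ₚ zero  = one
f ^ₚ suc m = f · (f ^ₚ m)

tTimes : PS → PS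
tTimes f zero    = 0
tTimes f (suc n) = f n

fussCatalan : ℕ → ℕ → ℕ
fussCatalan k n = (suc (k * n) C n) / suc (k * n)

Cgf : ℕ → PS
Cgf k = fussCatalan k

coeff : ℕ → PS → ℕ
coeff i f = f i

riordanEntry : PS → PS → ℕ → ℕ → ℕ
riordanEntry d h i j = coeff i (d · (h ^ₚ j))

-- Write γ₁ = N ∷ α and γ₂ = E ∷ β.  Both paths advance one antidiagonal per step, so
-- only points reached after equally many steps can coincide: walking the two paths in
-- lockstep, condition (3) says that the horizontal gap between their current points
-- never closes, and condition (5) says that β steps E only at positions divisible by
-- k - 1.  Counting these lockstep walks by their final gap, the number of walks of
-- length (k-1)m + q (q ≤ k - 2) ending with gap x is [tᵐ] tˣ C_k(t)^(2+q+kx).  The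
-- last ε steps of γ₂ are forced to be N (or form one whole block when ε = k - 1),
-- which gives [tⁱ] tʲ C_k(t)^(k-ε+kj) = [tⁱ] C_k(t)^(k-ε) (t C_k(t)^k)ʲ.  The
-- coefficients of C_k(t)^r are Raney numbers, generated by C^(r+1) = C^r + t C^(k+r)
-- and matched with the Fuss–Catalan numbers by their closed form r/(km+r) binom(km+r, m).

module Submission where

open import Defs
open import Data.Bool using (Bool; true; false; _∧_; _∨_; not; if_then_else_)
open import Data.Bool.Properties using (∧-identityʳ; ∧-assoc; ∧-zeroʳ; T-≡)
open import Data.Integer as ℤ using (ℤ; +_; _⊖_; ∣_∣)
open import Data.Integer.Properties using ([+m]-[+n]≡m⊖n; ⊖-≥; ∣⊖∣-<)
open import Data.List using (List; []; _∷_; _++_; length; map; concatMap; filterᵇ)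
open import Data.List.Properties using (++-identityʳ)
open import Data.Maybe using (Maybe; just; nothing; maybe′; _>>=_)
open import Data.Nat using (ℕ; zero; suc; _+_; _*_; _∸_; _/_; _≡ᵇ_; _≟_; _≤_; _<_; z≤n; s≤s; _≤?_)
open import Data.Nat using (NonZero; ≢-nonZero; >-nonZero; >-nonZero⁻¹)
open import Data.Nat.Combinatorics using (_C_; nCk+nC[k+1]≡[n+1]C[k+1]; k>n⇒nCk≡0; nC1≡n)
open import Data.Nat.Divisibility using (_∣_; _∣?_; ∣m+n∣m⇒∣n; ∣m∣n⇒∣m+n; n∣n; >⇒∤)
open import Data.Nat.DivMod using (m*n/n≡m)
open import Data.Nat.Properties
open import Data.Nat.Tactic.RingSolver using (solve-∀)
import Algebra.Properties.CommutativeSemigroup +-commutativeSemigroup as +-CS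
open import Data.Product using (_×_; _,_; proj₁; proj₂)
open import Function.Bundles using (_⇔_; mk⇔; Equivalence)
open import Relation.Nullary using (does; yes; no)
open import Relation.Nullary.Decidable using (does-⇔)
open import Relation.Nullary.Negation using (contradiction)
open import Relation.Binary.PropositionalEquality
open ≡-Reasoning

private variable A B : Set

-- Finite sums

𝟙 : Bool → ℕ
𝟙 true  = 1
𝟙 false = 0

𝟙[≡_] : ℕ → ℕ → ℕ
𝟙[≡ j ] h = 𝟙 (h ≡ᵇ j)

∑ : List A → (A → ℕ) → ℕ
∑ []       f = 0
∑ (x ∷ xs) f = f x + ∑ xs f

syntax ∑ xs (λ x → e) = ∑[ x ← xs ] e

∑-cong : (xs : List A) {f g : A → ℕ} → f ≗ g → ∑ xs f ≡ ∑ xs g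
∑-cong []       f≗g = refl
∑-cong (x ∷ xs) f≗g = cong₂ _+_ (f≗g x) (∑-cong xs f≗g)

∑-zero : (xs : List A) → ∑[ _ ← xs ] 0 ≡ 0
∑-zero []       = refl
∑-zero (_ ∷ xs) = ∑-zero xs

∑-vanishes : (xs : List A) {f : A → ℕ} → (∀ x → f x ≡ 0) → ∑ xs f ≡ 0
∑-vanishes xs f≡0 = trans (∑-cong xs f≡0) (∑-zero xs)

∑-++ : (xs ys : List A) (f : A → ℕ) → ∑ (xs ++ ys) f ≡ ∑ xs f + ∑ ys f
∑-++ []       ys f = refl
∑-++ (x ∷ xs) ys f = trans (cong (_+_ (f x)) (∑-++ xs ys f)) (sym (+-assoc (f x) _ _))

∑-distrib-+ : (xs : List A) (f g : A → ℕ) → ∑[ x ← xs ] (f x + g x) ≡ ∑ xs f + ∑ xs g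
∑-distrib-+ []       f g = refl
∑-distrib-+ (x ∷ xs) f g =
  trans (cong (_+_ (f x + g x)) (∑-distrib-+ xs f g)) (+-CS.interchange (f x) (g x) _ _)

∑-map : (g : A → B) (xs : List A) (f : B → ℕ) → ∑ (map g xs) f ≡ ∑[ x ← xs ] f (g x)
∑-map g []       f = refl
∑-map g (x ∷ xs) f = cong (_+_ (f (g x))) (∑-map g xs f)

∑-concatMap : (g : A → List B) (xs : List A) (f : B → ℕ) →
              ∑ (concatMap g xs) f ≡ ∑[ x ← xs ] (∑ (g x) f)
∑-concatMap g []       f = refl
∑-concatMap g (x ∷ xs) f = trans (∑-++ (g x) _ f) (cong (_+_ (∑ (g x) f)) (∑-concatMap g xs f))

∑-comm : (xs : List A) (ys : List B) (f : A → B → ℕ) →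
         ∑[ x ← xs ] ∑[ y ← ys ] f x y ≡ ∑[ y ← ys ] ∑[ x ← xs ] f x y
∑-comm []       ys f = sym (∑-zero ys)
∑-comm (x ∷ xs) ys f =
  trans (cong (_+_ (∑ ys (f x))) (∑-comm xs ys f)) (sym (∑-distrib-+ ys (f x) _))

length-filterᵇ : (p : A → Bool) (xs : List A) → length (filterᵇ p xs) ≡ ∑[ x ← xs ] 𝟙 (p x)
length-filterᵇ p []       = refl
length-filterᵇ p (x ∷ xs) with p x
... | true  = cong suc (length-filterᵇ p xs)
... | false = length-filterᵇ p xs

length-filterᵇ-pairs : (p : A × B → Bool) (xs : List A) (ys : List B) →
  length (filterᵇ p (concatMap (λ x → map (x ,_) ys) xs)) ≡ ∑[ x ← xs ] ∑[ y ← ys ] 𝟙 (p (x , y))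
length-filterᵇ-pairs p xs ys = begin
  length (filterᵇ p (concatMap (λ x → map (x ,_) ys) xs))
    ≡⟨ length-filterᵇ p (concatMap (λ x → map (x ,_) ys) xs) ⟩
  ∑[ xy ← concatMap (λ x → map (x ,_) ys) xs ] 𝟙 (p xy)
    ≡⟨ ∑-concatMap (λ x → map (x ,_) ys) xs _ ⟩
  ∑[ x ← xs ] ∑[ xy ← map (x ,_) ys ] 𝟙 (p xy)
    ≡⟨ ∑-cong xs (λ x → ∑-map (x ,_) ys _) ⟩
  ∑[ x ← xs ] ∑[ y ← ys ] 𝟙 (p (x , y)) ∎

∑-allPaths-suc : ∀ L (f : Path → ℕ) →
  ∑ (allPaths (suc L)) f ≡ ∑[ γ ← allPaths L ] f (E ∷ γ) + ∑[ γ ← allPaths L ] f (N ∷ γ)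
∑-allPaths-suc L f =
  trans (∑-++ (map (E ∷_) (allPaths L)) _ f) (cong₂ _+_ (∑-map _ (allPaths L) f) (∑-map _ (allPaths L) f))

∑-allPaths-+ : ∀ a b (f : Path → ℕ) →
  ∑ (allPaths (a + b)) f ≡ ∑[ α ← allPaths a ] ∑[ β ← allPaths b ] f (α ++ β)
∑-allPaths-+ zero    b f = sym (+-identityʳ _)
∑-allPaths-+ (suc a) b f = begin
  ∑ (allPaths (suc a + b)) f
    ≡⟨ ∑-allPaths-suc (a + b) f ⟩
  ∑[ γ ← allPaths (a + b) ] f (E ∷ γ) + ∑[ γ ← allPaths (a + b) ] f (N ∷ γ)
    ≡⟨ cong₂ _+_ (∑-allPaths-+ a b _) (∑-allPaths-+ a b _) ⟩
  _ ≡⟨ ∑-allPaths-suc a _ ⟨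
  ∑[ α ← allPaths (suc a) ] ∑[ β ← allPaths b ] f (α ++ β) ∎

∑-allPaths-cong : ∀ L {f g : Path → ℕ} → (∀ γ → length γ ≡ L → f γ ≡ g γ) →
  ∑ (allPaths L) f ≡ ∑ (allPaths L) g
∑-allPaths-cong zero    f≡g = cong (_+ 0) (f≡g [] refl)
∑-allPaths-cong (suc L) {f} {g} f≡g = begin
  ∑ (allPaths (suc L)) f ≡⟨ ∑-allPaths-suc L f ⟩
  _ ≡⟨ cong₂ _+_ (∑-allPaths-cong L (λ γ e → f≡g (E ∷ γ) (cong suc e)))
                 (∑-allPaths-cong L (λ γ e → f≡g (N ∷ γ) (cong suc e))) ⟩
  _ ≡⟨ ∑-allPaths-suc L g ⟨
  ∑ (allPaths (suc L)) g ∎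

∑-allPaths-N∷ : ∀ L (f : Path → ℕ) → (∀ γ → f (E ∷ γ) ≡ 0) →
  ∑ (allPaths (suc L)) f ≡ ∑[ γ ← allPaths L ] f (N ∷ γ)
∑-allPaths-N∷ L f fE≡0 =
  trans (∑-allPaths-suc L f) (cong (_+ ∑[ γ ← allPaths L ] f (N ∷ γ)) (∑-vanishes (allPaths L) fE≡0))

∑-allPaths-E∷ : ∀ L (f : Path → ℕ) → (∀ γ → f (N ∷ γ) ≡ 0) →
  ∑ (allPaths (suc L)) f ≡ ∑[ γ ← allPaths L ] f (E ∷ γ)
∑-allPaths-E∷ L f fN≡0 =
  trans (∑-allPaths-suc L f)
        (trans (cong (_+_ (∑[ γ ← allPaths L ] f (E ∷ γ))) (∑-vanishes (allPaths L) fN≡0)) (+-identityʳ _))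

-- Formal power series

sumUpTo-cong : ∀ n {f g : ℕ → ℕ} → (∀ i → i ≤ n → f i ≡ g i) → sumUpTo n f ≡ sumUpTo n g
sumUpTo-cong zero    f≡g = f≡g 0 z≤n
sumUpTo-cong (suc n) f≡g =
  cong₂ _+_ (sumUpTo-cong n (λ i i≤n → f≡g i (m≤n⇒m≤1+n i≤n))) (f≡g (suc n) ≤-refl)

sumUpTo-zero : ∀ n → sumUpTo n (λ _ → 0) ≡ 0
sumUpTo-zero zero    = refl
sumUpTo-zero (suc n) = cong (_+ 0) (sumUpTo-zero n)

sumUpTo-suc : ∀ n (f : ℕ → ℕ) → sumUpTo (suc n) f ≡ f 0 + sumUpTo n (λ i → f (suc i))
sumUpTo-suc zero    f = refl
sumUpTo-suc (suc n) f = begin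
  sumUpTo (suc n) f + f (suc (suc n))                 ≡⟨ cong (_+ f (suc (suc n))) (sumUpTo-suc n f) ⟩
  f 0 + sumUpTo n (λ i → f (suc i)) + f (suc (suc n)) ≡⟨ +-assoc (f 0) _ _ ⟩
  f 0 + sumUpTo (suc n) (λ i → f (suc i))             ∎

sumUpTo-distrib-+ : ∀ n (f g : ℕ → ℕ) → sumUpTo n (λ i → f i + g i) ≡ sumUpTo n f + sumUpTo n g
sumUpTo-distrib-+ zero    f g = refl
sumUpTo-distrib-+ (suc n) f g = begin
  sumUpTo n (λ i → f i + g i) + (f (suc n) + g (suc n))
    ≡⟨ cong (_+ (f (suc n) + g (suc n))) (sumUpTo-distrib-+ n f g) ⟩
  sumUpTo n f + sumUpTo n g + (f (suc n) + g (suc n))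
    ≡⟨ +-CS.interchange (sumUpTo n f) (sumUpTo n g) (f (suc n)) (g (suc n)) ⟩
  sumUpTo n f + f (suc n) + (sumUpTo n g + g (suc n)) ∎

·-cong : {f f′ g g′ : PS} → f ≗ f′ → g ≗ g′ → (f · g) ≗ (f′ · g′)
·-cong f≗f′ g≗g′ n = sumUpTo-cong n (λ i _ → cong₂ _*_ (f≗f′ i) (g≗g′ (n ∸ i)))

·-congʳ : (f : PS) {g g′ : PS} → g ≗ g′ → (f · g) ≗ (f · g′)
·-congʳ f = ·-cong {f} (λ _ → refl)

·-congˡ : {f f′ : PS} (g : PS) → f ≗ f′ → (f · g) ≗ (f′ · g)
·-congˡ g f≗f′ = ·-cong {g = g} f≗f′ (λ _ → refl)

·-identityˡ : (f : PS) → (one · f) ≗ f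
·-identityˡ f zero    = +-identityʳ (f 0)
·-identityˡ f (suc n) = begin
  sumUpTo (suc n) (λ i → one i * f (suc n ∸ i)) ≡⟨ sumUpTo-suc n _ ⟩
  f (suc n) + 0 + sumUpTo n (λ _ → 0)          ≡⟨ cong₂ _+_ (+-identityʳ (f (suc n))) (sumUpTo-zero n) ⟩
  f (suc n) + 0                                ≡⟨ +-identityʳ _ ⟩
  f (suc n)                                    ∎

·-distribʳ-+ : (f g h : PS) → ((λ i → f i + g i) · h) ≗ (λ n → (f · h) n + (g · h) n)
·-distribʳ-+ f g h n =
  trans (sumUpTo-cong n (λ i _ → *-distribʳ-+ (h (n ∸ i)) (f i) (g i))) (sumUpTo-distrib-+ n _ _)

tTimes-cong : {f g : PS} → f ≗ g → tTimes f ≗ tTimes g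
tTimes-cong f≗g zero    = refl
tTimes-cong f≗g (suc n) = f≗g n

tTimes-·ˡ : (f g : PS) → (tTimes f · g) ≗ tTimes (f · g)
tTimes-·ˡ f g zero    = refl
tTimes-·ˡ f g (suc n) = sumUpTo-suc n _

tTimes-·ʳ : (f g : PS) → (f · tTimes g) ≗ tTimes (f · g)
tTimes-·ʳ f g zero    = *-zeroʳ (f 0)
tTimes-·ʳ f g (suc n) = begin
  sumUpTo n (λ i → f i * tTimes g (suc n ∸ i)) + f (suc n) * tTimes g (suc n ∸ suc n)
    ≡⟨ cong₂ _+_ (sumUpTo-cong n (λ i i≤n → cong (λ d → f i * tTimes g d) (+-∸-assoc 1 i≤n)))
                 (cong (λ d → f (suc n) * tTimes g d) (n∸n≡0 n)) ⟩
  (f · g) n + f (suc n) * 0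
    ≡⟨ cong (_+_ ((f · g) n)) (*-zeroʳ (f (suc n))) ⟩
  (f · g) n + 0
    ≡⟨ +-identityʳ _ ⟩
  (f · g) n ∎

shift : ℕ → PS → PS
shift zero    f = f
shift (suc j) f = tTimes (shift j f)

shift-cong : ∀ j {f g : PS} → f ≗ g → shift j f ≗ shift j g
shift-cong zero    f≗g = f≗g
shift-cong (suc j) f≗g = tTimes-cong (shift-cong j f≗g)

shift-·ʳ : ∀ j (f g : PS) → (f · shift j g) ≗ shift j (f · g)
shift-·ʳ zero    f g n = refl
shift-·ʳ (suc j) f g n = trans (tTimes-·ʳ f (shift j g) n) (tTimes-cong (shift-·ʳ j f g) n)

^ₚ-cong : {f g : PS} → f ≗ g → ∀ j → (f ^ₚ j) ≗ (g ^ₚ j)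
^ₚ-cong f≗g zero    n = refl
^ₚ-cong f≗g (suc j)   = ·-cong f≗g (^ₚ-cong f≗g j)

tTimes-^ₚ : ∀ (f : PS) j → (tTimes f ^ₚ j) ≗ shift j (f ^ₚ j)
tTimes-^ₚ f zero    n = refl
tTimes-^ₚ f (suc j) n = begin
  (tTimes f · (tTimes f ^ₚ j)) n  ≡⟨ ·-congʳ (tTimes f) (tTimes-^ₚ f j) n ⟩
  (tTimes f · shift j (f ^ₚ j)) n ≡⟨ tTimes-·ˡ f (shift j (f ^ₚ j)) n ⟩
  tTimes (f · shift j (f ^ₚ j)) n ≡⟨ tTimes-cong (shift-·ʳ j f (f ^ₚ j)) n ⟩
  shift (suc j) (f ^ₚ suc j) n    ∎

-- Raney numbers

[1+k]*[1+n]C[1+k]≡[1+n]*nCk : ∀ n k → suc k * (suc n C suc k) ≡ suc n * (n C k)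
[1+k]*[1+n]C[1+k]≡[1+n]*nCk zero zero = refl
[1+k]*[1+n]C[1+k]≡[1+n]*nCk zero (suc k) = begin
  suc (suc k) * (1 C suc (suc k)) ≡⟨ cong (suc (suc k) *_) (k>n⇒nCk≡0 {1} {suc (suc k)} (s≤s (s≤s z≤n))) ⟩
  suc (suc k) * 0                 ≡⟨ *-zeroʳ (suc (suc k)) ⟩
  0                               ≡⟨ cong (1 *_) (k>n⇒nCk≡0 {0} {suc k} (s≤s z≤n)) ⟨
  1 * (0 C suc k)                 ∎
[1+k]*[1+n]C[1+k]≡[1+n]*nCk (suc n) zero = begin
  1 * (suc (suc n) C 1) ≡⟨ *-identityˡ _ ⟩
  suc (suc n) C 1       ≡⟨ nC1≡n (suc (suc n)) ⟩
  suc (suc n)           ≡⟨ *-identityʳ _ ⟨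
  suc (suc n) * 1       ∎
[1+k]*[1+n]C[1+k]≡[1+n]*nCk (suc n) (suc k) = begin
  suc (suc k) * (suc (suc n) C suc (suc k))
    ≡⟨ cong (suc (suc k) *_) (nCk+nC[k+1]≡[n+1]C[k+1] (suc n) (suc k)) ⟨
  suc (suc k) * (suc n C suc k + suc n C suc (suc k))
    ≡⟨ split (suc n C suc k) (suc n C suc (suc k)) k ⟩
  suc k * (suc n C suc k) + suc n C suc k + suc (suc k) * (suc n C suc (suc k))
    ≡⟨ cong₂ (λ a b → a + suc n C suc k + b)
             ([1+k]*[1+n]C[1+k]≡[1+n]*nCk n k) ([1+k]*[1+n]C[1+k]≡[1+n]*nCk n (suc k)) ⟩
  suc n * (n C k) + suc n C suc k + suc n * (n C suc k)
    ≡⟨ regroup (n C k) (n C suc k) (suc n C suc k) n ⟩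
  suc n * (n C k + n C suc k) + suc n C suc k
    ≡⟨ cong (λ c → suc n * c + suc n C suc k) (nCk+nC[k+1]≡[n+1]C[k+1] n k) ⟩
  suc n * (suc n C suc k) + suc n C suc k
    ≡⟨ +-comm (suc n * (suc n C suc k)) _ ⟩
  suc (suc n) * (suc n C suc k) ∎
  where
  split : ∀ a b k → suc (suc k) * (a + b) ≡ suc k * a + a + suc (suc k) * b
  split = solve-∀
  regroup : ∀ x y a n → suc n * x + a + suc n * y ≡ suc n * (x + y) + a
  regroup = solve-∀

module _ (k : ℕ) where

  -- raney r m = [tᵐ] C_k(t)^r
  raney : ℕ → ℕ → ℕ
  raney zero    zero    = 1
  raney zero    (suc m) = 0
  raney (suc r) zero    = raney r zero
  raney (suc r) (suc m) = raney r (suc m) + raney (k + r) m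

  raney-zero : ∀ r → raney r 0 ≡ 1
  raney-zero zero    = refl
  raney-zero (suc r) = raney-zero r

  raney0≗one : raney 0 ≗ one
  raney0≗one zero    = refl
  raney0≗one (suc m) = refl

  raney-suc : ∀ r → raney (suc r) ≗ (λ m → raney r m + tTimes (raney (k + r)) m)
  raney-suc r zero    = sym (+-identityʳ _)
  raney-suc r (suc m) = refl

  shift-raney-suc : ∀ h r → shift h (raney (suc r)) ≗ (λ m → shift h (raney r) m + shift (suc h) (raney (k + r)) m)
  shift-raney-suc zero    r m       = raney-suc r m
  shift-raney-suc (suc h) r zero    = refl
  shift-raney-suc (suc h) r (suc m) = shift-raney-suc h r m

  raney-+ : ∀ a b → (raney a · raney b) ≗ raney (a + b)
  raney-+ zero    b n = trans (·-congˡ (raney b) raney0≗one n) (·-identityˡ (raney b) n)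
  raney-+ (suc a) b n = begin
    (raney (suc a) · raney b) n
      ≡⟨ ·-congˡ (raney b) (raney-suc a) n ⟩
    ((λ m → raney a m + tTimes (raney (k + a)) m) · raney b) n
      ≡⟨ ·-distribʳ-+ (raney a) (tTimes (raney (k + a))) (raney b) n ⟩
    (raney a · raney b) n + (tTimes (raney (k + a)) · raney b) n
      ≡⟨ cong₂ _+_ (raney-+ a b n) (tTimes-·ˡ (raney (k + a)) (raney b) n) ⟩
    raney (a + b) n + tTimes (raney (k + a) · raney b) n
      ≡⟨ cong (_+_ (raney (a + b) n)) (shifted-product n) ⟩
    raney (a + b) n + tTimes (raney (k + (a + b))) n
      ≡⟨ raney-suc (a + b) n ⟨
    raney (suc a + b) n ∎
    where
    shifted-product : ∀ n → tTimes (raney (k + a) · raney b) n ≡ tTimes (raney (k + (a + b))) n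
    shifted-product zero     = refl
    shifted-product (suc n′) = trans (raney-+ (k + a) b n′) (cong (λ c → raney c n′) (+-assoc k a b))

  raney^ₚ : ∀ r j → (raney r ^ₚ j) ≗ raney (r * j)
  raney^ₚ r zero    n = trans (sym (raney0≗one n)) (cong (λ c → raney c n) (sym (*-zeroʳ r)))
  raney^ₚ r (suc j) n = begin
    (raney r · (raney r ^ₚ j)) n ≡⟨ ·-congʳ (raney r) (raney^ₚ r j) n ⟩
    (raney r · raney (r * j)) n  ≡⟨ raney-+ r (r * j) n ⟩
    raney (r + r * j) n          ≡⟨ cong (λ c → raney c n) (*-suc r j) ⟨
    raney (r * suc j) n          ∎

  raney-closed : .{{NonZero k}} → ∀ m r → (k * m + r) * raney r m ≡ r * ((k * m + r) C m)
  raney-closed zero    zero    = cong (λ c → (c + 0) * 1) (*-zeroʳ k)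
  raney-closed (suc m) zero    = *-zeroʳ (k * suc m + 0)
  raney-closed zero    (suc r) = begin
    (k * 0 + suc r) * raney r 0 ≡⟨ cong₂ (λ a b → (a + suc r) * b) (*-zeroʳ k) (raney-zero r) ⟩
    suc r * 1                   ∎
  raney-closed (suc m) (suc r) = *-cancelˡ-≡ _ _ M {{M-nonZero}} (begin
    M * ((k * suc m + suc r) * raney (suc r) (suc m))
      ≡⟨ cong (λ c → M * (c * raney (suc r) (suc m))) (+-suc (k * suc m) r) ⟩
    M * (suc M * (raney r (suc m) + raney (k + r) m))
      ≡⟨ distribute M (raney r (suc m)) (raney (k + r) m) ⟩
    suc M * (M * raney r (suc m)) + suc M * (M * raney (k + r) m)
      ≡⟨ cong₂ (λ a b → suc M * a + suc M * b) (raney-closed (suc m) r) IH ⟩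
    suc M * (r * (M C suc m)) + suc M * ((k + r) * (M C m))
      ≡⟨ regroup M r k (M C m) (M C suc m) ⟩
    r * (suc M * (M C m + M C suc m)) + k * (suc M * (M C m))
      ≡⟨ cong₂ (λ a b → r * (suc M * a) + k * b)
               (sym (nCk+nC[k+1]≡[n+1]C[k+1] M m)) ([1+k]*[1+n]C[1+k]≡[1+n]*nCk M m) ⟨
    r * (suc M * (suc M C suc m)) + k * (suc m * (suc M C suc m))
      ≡⟨ collect r k m (suc M C suc m) ⟩
    M * (suc r * (suc M C suc m))
      ≡⟨ cong (λ c → M * (suc r * (c C suc m))) (+-suc (k * suc m) r) ⟨
    M * (suc r * ((k * suc m + suc r) C suc m)) ∎)
    where
    M = k * suc m + r
    M-nonZero : NonZero M
    M-nonZero = >-nonZero (<-≤-trans (>-nonZero⁻¹ (k * suc m) {{m*n≢0 k (suc m)}}) (m≤m+n _ r))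
    IH : M * raney (k + r) m ≡ (k + r) * (M C m)
    IH = subst (λ c → c * raney (k + r) m ≡ (k + r) * (c C m)) (shape k m r) (raney-closed m (k + r))
      where
      shape : ∀ k m r → k * m + (k + r) ≡ k * suc m + r
      shape = solve-∀
    distribute : ∀ M a b → M * (suc M * (a + b)) ≡ suc M * (M * a) + suc M * (M * b)
    distribute = solve-∀
    regroup : ∀ M r k c c′ → suc M * (r * c′) + suc M * ((k + r) * c) ≡ r * (suc M * (c + c′)) + k * (suc M * c)
    regroup = solve-∀
    collect : ∀ r k m c → r * (suc (k * suc m + r) * c) + k * (suc m * c) ≡ (k * suc m + r) * (suc r * c)
    collect = solve-∀

  fussCatalan≡raney1 : .{{NonZero k}} → ∀ m → fussCatalan k m ≡ raney 1 m
  fussCatalan≡raney1 m = begin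
    (suc (k * m) C m) / suc (k * m)     ≡⟨ cong (_/ suc (k * m)) closed ⟨
    (raney 1 m * suc (k * m)) / suc (k * m) ≡⟨ m*n/n≡m (raney 1 m) (suc (k * m)) ⟩
    raney 1 m                           ∎
    where
    closed : raney 1 m * suc (k * m) ≡ suc (k * m) C m
    closed = begin
      raney 1 m * suc (k * m)  ≡⟨ *-comm (raney 1 m) _ ⟩
      suc (k * m) * raney 1 m  ≡⟨ cong (_* raney 1 m) (+-comm 1 (k * m)) ⟩
      (k * m + 1) * raney 1 m  ≡⟨ raney-closed m 1 ⟩
      1 * ((k * m + 1) C m)    ≡⟨ *-identityˡ _ ⟩
      (k * m + 1) C m          ≡⟨ cong (_C m) (+-comm (k * m) 1) ⟩
      suc (k * m) C m          ∎

  Cgf^ₚ≗raney : .{{NonZero k}} → ∀ r → (Cgf k ^ₚ r) ≗ raney r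
  Cgf^ₚ≗raney zero    n = sym (raney0≗one n)
  Cgf^ₚ≗raney (suc r) n = trans (·-cong fussCatalan≡raney1 (Cgf^ₚ≗raney r) n) (raney-+ 1 r n)

  riordanEntry-Cgf : .{{NonZero k}} → ∀ a i j →
    riordanEntry (Cgf k ^ₚ a) (tTimes (Cgf k ^ₚ k)) i j ≡ shift j (raney (a + k * j)) i
  riordanEntry-Cgf a i j = begin
    ((Cgf k ^ₚ a) · (tTimes (Cgf k ^ₚ k) ^ₚ j)) i ≡⟨ ·-cong (Cgf^ₚ≗raney a) h^j i ⟩
    (raney a · shift j (raney (k * j))) i         ≡⟨ shift-·ʳ j (raney a) (raney (k * j)) i ⟩
    shift j (raney a · raney (k * j)) i           ≡⟨ shift-cong j (raney-+ a (k * j)) i ⟩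
    shift j (raney (a + k * j)) i                 ∎
    where
    h^j : (tTimes (Cgf k ^ₚ k) ^ₚ j) ≗ shift j (raney (k * j))
    h^j n = trans (tTimes-^ₚ (Cgf k ^ₚ k) j n)
                  (shift-cong j (λ m → trans (^ₚ-cong (Cgf^ₚ≗raney k) j m) (raney^ₚ k j m)) n)

-- Lockstep walks

maybe′-0-cong : {f g : A → ℕ} → f ≗ g → (m : Maybe A) → maybe′ f 0 m ≡ maybe′ g 0 m
maybe′-0-cong f≗g (just x) = f≗g x
maybe′-0-cong f≗g nothing  = refl

maybe′-0-zero : (m : Maybe A) → maybe′ (λ _ → 0) 0 m ≡ 0
maybe′-0-zero (just _) = refl
maybe′-0-zero nothing  = refl

maybe′-0-+ : (f g : A → ℕ) (m : Maybe A) → maybe′ (λ x → f x + g x) 0 m ≡ maybe′ f 0 m + maybe′ g 0 m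
maybe′-0-+ f g (just x) = refl
maybe′-0-+ f g nothing  = refl

maybe′-0-∑ : (ys : List B) (G : B → A → ℕ) (m : Maybe A) →
  maybe′ (λ x → ∑[ y ← ys ] G y x) 0 m ≡ ∑[ y ← ys ] maybe′ (G y) 0 m
maybe′-0-∑ ys G (just x) = refl
maybe′-0-∑ ys G nothing  = sym (∑-zero ys)

maybe′-0->>= : (g : B → ℕ) (m : Maybe A) (f : A → Maybe B) →
  maybe′ g 0 (m >>= f) ≡ maybe′ (λ x → maybe′ g 0 (f x)) 0 m
maybe′-0->>= g (just x) f = refl
maybe′-0->>= g nothing  f = refl

if-∧->>= : (b p : Bool) (m : Maybe A) (f : A → Maybe B) →
  (if b ∧ p then m >>= f else nothing) ≡ ((if b then m else nothing) >>= λ x → if p then f x else nothing)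
if-∧->>= false p m        f = refl
if-∧->>= true  p (just x) f = refl
if-∧->>= true  false nothing f = refl
if-∧->>= true  true  nothing f = refl

gapStep : ℕ → Step → Step → Maybe ℕ
gapStep h       N N = just h
gapStep h       N E = just (suc h)
gapStep h       E E = just h
gapStep zero    E N = nothing
gapStep (suc h) E N = just h

-- h + 1 is the horizontal distance between the current points of the two paths, which
-- lie on one antidiagonal.  Steps of β after α has ended are paired with N: the rest of β
-- lies beyond γ₁, and the gap then changes exactly as the x-coordinate of γ₂ does.
gapWalk : ℕ → Path → Path → Maybe ℕ
gapWalk h []      []      = just h
gapWalk h (_ ∷ _) []      = nothing
gapWalk h []      (b ∷ β) = gapStep h N b >>= λ h′ → gapWalk h′ [] β
gapWalk h (a ∷ α) (b ∷ β) = gapStep h a b >>= λ h′ → gapWalk h′ α β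

gapWalk-++ : ∀ h (α β α′ β′ : Path) → length α ≡ length β →
  gapWalk h (α ++ α′) (β ++ β′) ≡ (gapWalk h α β >>= λ h′ → gapWalk h′ α′ β′)
gapWalk-++ h []      []      α′ β′ _ = refl
gapWalk-++ h (a ∷ α) (b ∷ β) α′ β′ e with gapStep h a b
... | nothing = refl
... | just h′ = gapWalk-++ h′ α β α′ β′ (suc-injective e)

#E : Path → ℕ
#E []      = 0
#E (E ∷ β) = suc (#E β)
#E (N ∷ β) = #E β

gapWalk-padded : ∀ h β → gapWalk h [] β ≡ just (h + #E β)
gapWalk-padded h []      = cong just (sym (+-identityʳ h))
gapWalk-padded h (E ∷ β) = trans (gapWalk-padded (suc h) β) (cong just (sym (+-suc h (#E β))))
gapWalk-padded h (N ∷ β) = gapWalk-padded h β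

module _ (R : ℕ) where

  private
    K k : ℕ
    K = suc R
    k = suc K

  -- The phase is the number of N steps γ₂ must still take before it may step E.
  nextPhase : ℕ → ℕ
  nextPhase zero    = R
  nextPhase (suc r) = r

  phase : ℕ → ℕ → ℕ
  phase r zero    = r
  phase r (suc ℓ) = phase (nextPhase r) ℓ

  phase-+ : ∀ r a b → phase r (a + b) ≡ phase (phase r a) b
  phase-+ r zero    b = refl
  phase-+ r (suc a) b = phase-+ (nextPhase r) a b

  phase-cycle : ∀ r → phase r (suc r) ≡ R
  phase-cycle zero    = refl
  phase-cycle (suc r) = phase-cycle r

  phase-≤ : ∀ r q → q ≤ r → phase r q ≡ r ∸ q
  phase-≤ r       zero    _         = refl
  phase-≤ (suc r) (suc q) (s≤s q≤r) = phase-≤ r q q≤r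

  phase-periodic : ∀ m → phase R (K * m) ≡ R
  phase-periodic zero    = cong (phase R) (*-zeroʳ K)
  phase-periodic (suc m) = begin
    phase R (K * suc m)           ≡⟨ cong (phase R) (*-suc K m) ⟩
    phase R (K + K * m)           ≡⟨ phase-+ R K (K * m) ⟩
    phase (phase R K) (K * m)     ≡⟨ cong (λ r → phase r (K * m)) (phase-cycle R) ⟩
    phase R (K * m)               ≡⟨ phase-periodic m ⟩
    R                             ∎

  phase-periodic-+ : ∀ m q → q ≤ R → phase R (K * m + q) ≡ R ∸ q
  phase-periodic-+ m q q≤R = begin
    phase R (K * m + q)           ≡⟨ phase-+ R (K * m) q ⟩
    phase (phase R (K * m)) q     ≡⟨ cong (λ r → phase r q) (phase-periodic m) ⟩
    phase R q                     ≡⟨ phase-≤ R q q≤R ⟩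
    R ∸ q                         ∎

  phase-blockEnd : ∀ i L → suc L ≡ K * suc i → phase R L ≡ 0
  phase-blockEnd i L |L| = begin
    phase R L             ≡⟨ cong (phase R) (suc-injective (trans |L| (trans (*-suc K i) (cong suc (+-comm R (K * i)))))) ⟩
    phase R (K * i + R)   ≡⟨ phase-periodic-+ i R ≤-refl ⟩
    R ∸ R                 ≡⟨ n∸n≡0 R ⟩
    0                     ∎

  -- With ending at phase 0, condition (5) on E ∷ β says that β steps E only at phase 0.
  phaseOK : ℕ → Path → Bool
  phaseOK r       []      = true
  phaseOK r       (N ∷ β) = phaseOK (nextPhase r) β
  phaseOK zero    (E ∷ β) = phaseOK R β
  phaseOK (suc r) (E ∷ β) = false

  phaseOK-++ : ∀ r (β β′ : Path) → phaseOK r (β ++ β′) ≡ phaseOK r β ∧ phaseOK (phase r (length β)) β′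
  phaseOK-++ r       []      β′ = refl
  phaseOK-++ r       (N ∷ β) β′ = phaseOK-++ (nextPhase r) β β′
  phaseOK-++ zero    (E ∷ β) β′ = phaseOK-++ R β β′
  phaseOK-++ (suc r) (E ∷ β) β′ = refl

  walk : ℕ → ℕ → Path → Path → Maybe ℕ
  walk r h α β = if phaseOK r β then gapWalk h α β else nothing

  walk-++ : ∀ r h (α β α′ β′ : Path) → length α ≡ length β →
    walk r h (α ++ α′) (β ++ β′) ≡ (walk r h α β >>= λ h′ → walk (phase r (length β)) h′ α′ β′)
  walk-++ r h α β α′ β′ |α|≡|β| = begin
    walk r h (α ++ α′) (β ++ β′)
      ≡⟨ cong₂ (λ b m → if b then m else nothing) (phaseOK-++ r β β′) (gapWalk-++ h α β α′ β′ |α|≡|β|) ⟩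
    (if phaseOK r β ∧ phaseOK (phase r (length β)) β′ then gapWalk h α β >>= (λ h′ → gapWalk h′ α′ β′) else nothing)
      ≡⟨ if-∧->>= (phaseOK r β) _ (gapWalk h α β) _ ⟩
    (walk r h α β >>= λ h′ → walk (phase r (length β)) h′ α′ β′) ∎

  -- From phase e the only admissible β of length e is Nᵉ.
  ∑-padded-walk : ∀ e h (g : ℕ → ℕ) → ∑[ β ← allPaths e ] maybe′ g 0 (walk e h [] β) ≡ g h
  ∑-padded-walk zero    h g = +-identityʳ (g h)
  ∑-padded-walk (suc e) h g = trans (∑-allPaths-N∷ e _ (λ _ → refl)) (∑-padded-walk e h g)

  ∑-padded-walk-block : ∀ h (g : ℕ → ℕ) → ∑[ β ← allPaths K ] maybe′ g 0 (walk 0 h [] β) ≡ g (suc h) + g h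
  ∑-padded-walk-block h g =
    trans (∑-allPaths-suc R _) (cong₂ _+_ (∑-padded-walk R (suc h) g) (∑-padded-walk R h g))

  -- A pair (α , β) stands for (N ∷ α , E ∷ β): the walk starts at phase R with gap 0.
  walkSum : ℕ → (ℕ → ℕ) → ℕ
  walkSum ℓ g = ∑[ α ← allPaths ℓ ] ∑[ β ← allPaths ℓ ] maybe′ g 0 (walk R 0 α β)

  walkSum-cong : ∀ ℓ {g g′ : ℕ → ℕ} → g ≗ g′ → walkSum ℓ g ≡ walkSum ℓ g′
  walkSum-cong ℓ g≗g′ =
    ∑-cong (allPaths ℓ) (λ α → ∑-cong (allPaths ℓ) (λ β → maybe′-0-cong g≗g′ (walk R 0 α β)))

  walkSum-zero : ∀ ℓ → walkSum ℓ (λ _ → 0) ≡ 0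
  walkSum-zero ℓ =
    ∑-vanishes (allPaths ℓ) (λ α → ∑-vanishes (allPaths ℓ) (λ β → maybe′-0-zero (walk R 0 α β)))

  walkSum-+ : ∀ ℓ (g g′ : ℕ → ℕ) → walkSum ℓ (λ h → g h + g′ h) ≡ walkSum ℓ g + walkSum ℓ g′
  walkSum-+ ℓ g g′ = begin
    walkSum ℓ (λ h → g h + g′ h)
      ≡⟨ ∑-cong (allPaths ℓ) (λ α → ∑-cong (allPaths ℓ) (λ β → maybe′-0-+ g g′ (walk R 0 α β))) ⟩
    ∑[ α ← allPaths ℓ ] ∑[ β ← allPaths ℓ ] (w g α β + w g′ α β)
      ≡⟨ ∑-cong (allPaths ℓ) (λ α → ∑-distrib-+ (allPaths ℓ) (w g α) (w g′ α)) ⟩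
    ∑[ α ← allPaths ℓ ] (∑[ β ← allPaths ℓ ] w g α β + ∑[ β ← allPaths ℓ ] w g′ α β)
      ≡⟨ ∑-distrib-+ (allPaths ℓ) _ _ ⟩
    walkSum ℓ g + walkSum ℓ g′ ∎
    where
    w : (ℕ → ℕ) → Path → Path → ℕ
    w g α β = maybe′ g 0 (walk R 0 α β)

  walkSum-extend : ∀ ℓ a b (g : ℕ → ℕ) →
    ∑[ α ← allPaths ℓ ] ∑[ β ← allPaths ℓ ] ∑[ α′ ← allPaths a ] ∑[ β′ ← allPaths b ]
      maybe′ g 0 (walk R 0 (α ++ α′) (β ++ β′))
    ≡ walkSum ℓ (λ h → ∑[ α′ ← allPaths a ] ∑[ β′ ← allPaths b ] maybe′ g 0 (walk (phase R ℓ) h α′ β′))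
  walkSum-extend ℓ a b g = ∑-allPaths-cong ℓ (λ α |α| → ∑-allPaths-cong ℓ (λ β |β| → begin
    ∑[ α′ ← allPaths a ] ∑[ β′ ← allPaths b ] maybe′ g 0 (walk R 0 (α ++ α′) (β ++ β′))
      ≡⟨ ∑-cong (allPaths a) (λ α′ → ∑-cong (allPaths b) (λ β′ → split α β α′ β′ |α| |β|)) ⟩
    ∑[ α′ ← allPaths a ] ∑[ β′ ← allPaths b ] maybe′ (tail α′ β′) 0 (walk R 0 α β)
      ≡⟨ ∑-cong (allPaths a) (λ α′ → maybe′-0-∑ (allPaths b) (tail α′) (walk R 0 α β)) ⟨
    ∑[ α′ ← allPaths a ] maybe′ (λ h → ∑[ β′ ← allPaths b ] tail α′ β′ h) 0 (walk R 0 α β)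
      ≡⟨ maybe′-0-∑ (allPaths a) (λ α′ h → ∑[ β′ ← allPaths b ] tail α′ β′ h) (walk R 0 α β) ⟨
    maybe′ (λ h → ∑[ α′ ← allPaths a ] ∑[ β′ ← allPaths b ] tail α′ β′ h) 0 (walk R 0 α β) ∎))
    where
    tail : Path → Path → ℕ → ℕ
    tail α′ β′ h = maybe′ g 0 (walk (phase R ℓ) h α′ β′)
    split : ∀ α β α′ β′ → length α ≡ ℓ → length β ≡ ℓ →
      maybe′ g 0 (walk R 0 (α ++ α′) (β ++ β′)) ≡ maybe′ (tail α′ β′) 0 (walk R 0 α β)
    split α β α′ β′ refl |β| = begin
      maybe′ g 0 (walk R 0 (α ++ α′) (β ++ β′))
        ≡⟨ cong (maybe′ g 0) (walk-++ R 0 α β α′ β′ (sym |β|)) ⟩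
      maybe′ g 0 (walk R 0 α β >>= λ h → walk (phase R (length β)) h α′ β′)
        ≡⟨ maybe′-0->>= g (walk R 0 α β) _ ⟩
      maybe′ (λ h → maybe′ g 0 (walk (phase R (length β)) h α′ β′)) 0 (walk R 0 α β)
        ≡⟨ cong (λ ℓ′ → maybe′ (λ h → maybe′ g 0 (walk (phase R ℓ′) h α′ β′)) 0 (walk R 0 α β)) |β| ⟩
      maybe′ (tail α′ β′) 0 (walk R 0 α β) ∎

  stepSum : ℕ → ℕ → (ℕ → ℕ) → ℕ
  stepSum r h g = ∑[ a ← allPaths 1 ] ∑[ b ← allPaths 1 ] maybe′ g 0 (walk r h a b)

  walkSum-suc : ∀ ℓ (g : ℕ → ℕ) → walkSum (suc ℓ) g ≡ walkSum ℓ (λ h → stepSum (phase R ℓ) h g)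
  walkSum-suc ℓ g = begin
    ∑[ α ← allPaths (suc ℓ) ] ∑[ β ← allPaths (suc ℓ) ] w α β
      ≡⟨ ∑-cong (allPaths (suc ℓ)) (λ α → split-last (w α)) ⟩
    ∑[ α ← allPaths (suc ℓ) ] ∑[ β ← allPaths ℓ ] ∑[ β′ ← allPaths 1 ] w α (β ++ β′)
      ≡⟨ split-last _ ⟩
    ∑[ α ← allPaths ℓ ] ∑[ α′ ← allPaths 1 ] ∑[ β ← allPaths ℓ ] ∑[ β′ ← allPaths 1 ] w (α ++ α′) (β ++ β′)
      ≡⟨ ∑-cong (allPaths ℓ) (λ α →
           ∑-comm (allPaths 1) (allPaths ℓ) (λ α′ β → ∑[ β′ ← allPaths 1 ] w (α ++ α′) (β ++ β′))) ⟩
    ∑[ α ← allPaths ℓ ] ∑[ β ← allPaths ℓ ] ∑[ α′ ← allPaths 1 ] ∑[ β′ ← allPaths 1 ] w (α ++ α′) (β ++ β′)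
      ≡⟨ walkSum-extend ℓ 1 1 g ⟩
    walkSum ℓ (λ h → stepSum (phase R ℓ) h g) ∎
    where
    w : Path → Path → ℕ
    w α β = maybe′ g 0 (walk R 0 α β)
    split-last : (f : Path → ℕ) → ∑ (allPaths (suc ℓ)) f ≡ ∑[ γ ← allPaths ℓ ] ∑[ s ← allPaths 1 ] f (γ ++ s)
    split-last f = trans (cong (λ L → ∑ (allPaths L) f) (+-comm 1 ℓ)) (∑-allPaths-+ ℓ 1 f)

  atPred : (ℕ → ℕ) → ℕ → ℕ
  atPred g zero    = 0
  atPred g (suc h) = g h

  -- Away from phase 0 the step of β is N; at phase 0 all four pairs of steps may occur.
  stepSum-inBlock : ∀ r h g → stepSum (suc r) h g ≡ atPred g h + g h
  stepSum-inBlock r h g = trans (unfold h) (shape (atPred g h) (g h))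
    where
    unfold : ∀ h → stepSum (suc r) h g ≡ 0 + (atPred g h + 0) + (0 + (g h + 0) + 0)
    unfold zero    = refl
    unfold (suc h) = refl
    shape : ∀ a b → 0 + (a + 0) + (0 + (b + 0) + 0) ≡ a + b
    shape = solve-∀

  stepSum-blockEnd : ∀ h g → stepSum 0 h g ≡ g h + atPred g h + g (suc h) + g h
  stepSum-blockEnd h g = trans (unfold h) (shape (g h) (atPred g h) (g (suc h)))
    where
    unfold : ∀ h → stepSum 0 h g ≡ g h + (atPred g h + 0) + (g (suc h) + (g h + 0) + 0)
    unfold zero    = refl
    unfold (suc h) = refl
    shape : ∀ a b c → a + (b + 0) + (c + (a + 0) + 0) ≡ a + b + c + a
    shape = solve-∀

  walks : ℕ → ℕ → ℕ
  walks ℓ x = walkSum ℓ 𝟙[≡ x ]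

  walks⁻ : ℕ → ℕ → ℕ
  walks⁻ ℓ zero    = 0
  walks⁻ ℓ (suc x) = walks ℓ x

  walkSum-𝟙[≡suc] : ∀ ℓ x → walkSum ℓ (λ h → 𝟙[≡ x ] (suc h)) ≡ walks⁻ ℓ x
  walkSum-𝟙[≡suc] ℓ zero    = walkSum-zero ℓ
  walkSum-𝟙[≡suc] ℓ (suc x) = refl

  atPred-𝟙[≡] : ∀ x h → atPred 𝟙[≡ x ] h ≡ 𝟙[≡ suc x ] h
  atPred-𝟙[≡] x zero    = refl
  atPred-𝟙[≡] x (suc h) = refl

  walks-inBlock : ∀ ℓ r → phase R ℓ ≡ suc r → ∀ x → walks (suc ℓ) x ≡ walks ℓ (suc x) + walks ℓ x
  walks-inBlock ℓ r ph x = begin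
    walks (suc ℓ) x
      ≡⟨ walkSum-suc ℓ 𝟙[≡ x ] ⟩
    walkSum ℓ (λ h → stepSum (phase R ℓ) h 𝟙[≡ x ])
      ≡⟨ walkSum-cong ℓ (λ h → trans (cong (λ r′ → stepSum r′ h 𝟙[≡ x ]) ph)
                                     (trans (stepSum-inBlock r h 𝟙[≡ x ]) (cong (_+ 𝟙[≡ x ] h) (atPred-𝟙[≡] x h)))) ⟩
    walkSum ℓ (λ h → 𝟙[≡ suc x ] h + 𝟙[≡ x ] h)
      ≡⟨ walkSum-+ ℓ 𝟙[≡ suc x ] 𝟙[≡ x ] ⟩
    walks ℓ (suc x) + walks ℓ x ∎

  walks-blockEnd : ∀ ℓ → phase R ℓ ≡ 0 → ∀ x →
    walks (suc ℓ) x ≡ walks ℓ x + walks ℓ (suc x) + walks⁻ ℓ x + walks ℓ x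
  walks-blockEnd ℓ ph x = begin
    walks (suc ℓ) x
      ≡⟨ walkSum-suc ℓ 𝟙[≡ x ] ⟩
    walkSum ℓ (λ h → stepSum (phase R ℓ) h 𝟙[≡ x ])
      ≡⟨ walkSum-cong ℓ (λ h → trans (cong (λ r → stepSum r h 𝟙[≡ x ]) ph)
                                     (trans (stepSum-blockEnd h 𝟙[≡ x ])
                                            (cong (λ c → 𝟙[≡ x ] h + c + 𝟙[≡ x ] (suc h) + 𝟙[≡ x ] h) (atPred-𝟙[≡] x h)))) ⟩
    walkSum ℓ (λ h → 𝟙[≡ x ] h + 𝟙[≡ suc x ] h + 𝟙[≡ x ] (suc h) + 𝟙[≡ x ] h)
      ≡⟨ walkSum-+ ℓ (λ h → 𝟙[≡ x ] h + 𝟙[≡ suc x ] h + 𝟙[≡ x ] (suc h)) 𝟙[≡ x ] ⟩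
    walkSum ℓ (λ h → 𝟙[≡ x ] h + 𝟙[≡ suc x ] h + 𝟙[≡ x ] (suc h)) + walks ℓ x
      ≡⟨ cong (_+ walks ℓ x) (walkSum-+ ℓ (λ h → 𝟙[≡ x ] h + 𝟙[≡ suc x ] h) (λ h → 𝟙[≡ x ] (suc h))) ⟩
    walkSum ℓ (λ h → 𝟙[≡ x ] h + 𝟙[≡ suc x ] h) + walkSum ℓ (λ h → 𝟙[≡ x ] (suc h)) + walks ℓ x
      ≡⟨ cong₂ (λ a b → a + b + walks ℓ x) (walkSum-+ ℓ 𝟙[≡ x ] 𝟙[≡ suc x ]) (walkSum-𝟙[≡suc] ℓ x) ⟩
    walks ℓ x + walks ℓ (suc x) + walks⁻ ℓ x + walks ℓ x ∎

  walks-closed-inBlock : ∀ m q → suc q ≤ R →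
    (∀ x → walks (K * m + q) x ≡ shift x (raney k (2 + q + k * x)) m) →
    ∀ x → walks (K * m + suc q) x ≡ shift x (raney k (2 + suc q + k * x)) m
  walks-closed-inBlock m q 1+q≤R IH x = begin
    walks (K * m + suc q) x
      ≡⟨ cong (λ ℓ → walks ℓ x) (+-suc (K * m) q) ⟩
    walks (suc (K * m + q)) x
      ≡⟨ walks-inBlock (K * m + q) (R ∸ suc q) inBlock x ⟩
    walks (K * m + q) (suc x) + walks (K * m + q) x
      ≡⟨ cong₂ _+_ (IH (suc x)) (IH x) ⟩
    shift (suc x) (raney k (2 + q + k * suc x)) m + shift x (raney k e) m
      ≡⟨ +-comm (shift (suc x) (raney k (2 + q + k * suc x)) m) _ ⟩
    shift x (raney k e) m + shift (suc x) (raney k (2 + q + k * suc x)) m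
      ≡⟨ cong (λ r → shift x (raney k e) m + shift (suc x) (raney k r) m) (shape k q x) ⟩
    shift x (raney k e) m + shift (suc x) (raney k (k + e)) m
      ≡⟨ shift-raney-suc k x e m ⟨
    shift x (raney k (2 + suc q + k * x)) m ∎
    where
    e = 2 + q + k * x
    inBlock : phase R (K * m + q) ≡ suc (R ∸ suc q)
    inBlock = trans (phase-periodic-+ m q (≤-trans (n≤1+n q) 1+q≤R)) (+-∸-assoc 1 1+q≤R)
    shape : ∀ k q x → 2 + q + k * suc x ≡ k + (2 + q + k * x)
    shape k q x = trans (cong (_+_ (2 + q)) (*-suc k x)) (+-shape k q (k * x))
      where
      +-shape : ∀ k q y → 2 + q + (k + y) ≡ k + (2 + q + y)
      +-shape = solve-∀

  walks⁻-closed-blockEnd : ∀ m → (∀ x → walks (K * m + R) x ≡ shift x (raney k (k + k * x)) m) →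
    ∀ x → walks⁻ (K * m + R) x ≡ shift x (raney k (k * x)) (suc m)
  walks⁻-closed-blockEnd m IH zero    = cong (λ r → raney k r (suc m)) (sym (*-zeroʳ k))
  walks⁻-closed-blockEnd m IH (suc x) = trans (IH x) (cong (λ r → shift x (raney k r) m) (sym (*-suc k x)))

  walks-closed-nextBlock : ∀ m → (∀ x → walks (K * m + R) x ≡ shift x (raney k (k + k * x)) m) →
    ∀ x → walks (K * suc m + 0) x ≡ shift x (raney k (2 + 0 + k * x)) (suc m)
  walks-closed-nextBlock m IH x = begin
    walks (K * suc m + 0) x
      ≡⟨ cong (λ ℓ → walks ℓ x) lastStep ⟩
    walks (suc ℓ) x
      ≡⟨ walks-blockEnd ℓ (trans (phase-periodic-+ m R ≤-refl) (n∸n≡0 R)) x ⟩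
    walks ℓ x + walks ℓ (suc x) + walks⁻ ℓ x + walks ℓ x
      ≡⟨ cong₂ (λ a b → a + b + walks⁻ ℓ x + a) (IH x) (IH (suc x)) ⟩
    w + shift (suc x) (raney k (k + k * suc x)) m + walks⁻ ℓ x + w
      ≡⟨ cong₂ (λ a b → w + a + b + w) (cong (λ r → shift (suc x) (raney k (k + r)) m) (*-suc k x))
                                       (walks⁻-closed-blockEnd m IH x) ⟩
    w + w⁺ + w⁻ + w
      ≡⟨ regroup w⁻ w w⁺ ⟩
    (w⁻ + w) + (w + w⁺)
      ≡⟨ cong₂ _+_ (shift-raney-suc k x (k * x) (suc m))
                   (trans (cong (λ r → shift x (raney k r) m) (+-suc k (k * x))) (shift-raney-suc k x (k + k * x) m)) ⟨
    shift x (raney k (suc (k * x))) (suc m) + shift (suc x) (raney k (k + suc (k * x))) (suc m)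
      ≡⟨ shift-raney-suc k x (suc (k * x)) (suc m) ⟨
    shift x (raney k (2 + 0 + k * x)) (suc m) ∎
    where
    ℓ = K * m + R
    w⁻ = shift x (raney k (k * x)) (suc m)
    w  = shift x (raney k (k + k * x)) m
    w⁺ = shift (suc x) (raney k (k + (k + k * x))) m
    lastStep : K * suc m + 0 ≡ suc ℓ
    lastStep = trans (+-identityʳ _) (trans (*-suc K m) (trans (+-comm K (K * m)) (+-suc (K * m) R)))
    regroup : ∀ a b c → b + c + a + b ≡ a + b + (b + c)
    regroup = solve-∀

  walks-closed : ∀ m q → q ≤ R → ∀ x → walks (K * m + q) x ≡ shift x (raney k (2 + q + k * x)) m
  walks-closed zero    zero    _     x = trans (cong (λ ℓ → walks (ℓ + 0) x) (*-zeroʳ K)) (walks-zero x)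
    where
    walks-zero : ∀ x → walks 0 x ≡ shift x (raney k (2 + 0 + k * x)) 0
    walks-zero zero    = sym (raney-zero k (2 + k * 0))
    walks-zero (suc x) = refl
  walks-closed (suc m) zero    _     = walks-closed-nextBlock m (walks-closed m R ≤-refl)
  walks-closed m       (suc q) 1+q≤R = walks-closed-inBlock m q 1+q≤R (walks-closed m q (≤-trans (n≤1+n q) 1+q≤R))

-- The defining conditions as lockstep walks

≡⇒≡ᵇ-true : ∀ {m n} → m ≡ n → (m ≡ᵇ n) ≡ true
≡⇒≡ᵇ-true {m} {n} m≡n = Equivalence.to T-≡ (≡⇒≡ᵇ m n m≡n)

≢⇒≡ᵇ-false : ∀ {m n} → m ≢ n → (m ≡ᵇ n) ≡ false
≢⇒≡ᵇ-false {m} {n} m≢n with m ≡ᵇ n in eq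
... | true  = contradiction (≡ᵇ⇒≡ m n (Equivalence.from T-≡ eq)) m≢n
... | false = refl

level : Point → ℕ
level (x , y) = x + y

level-move : ∀ p s → level (move p s) ≡ suc (level p)
level-move (x , y) E = refl
level-move (x , y) N = +-suc x y

==ₚ⇒level≡ : ∀ p q → (p ==ₚ q) ≡ true → level p ≡ level q
==ₚ⇒level≡ (x , y) (x′ , y′) eq with x ≡ᵇ x′ in ex | y ≡ᵇ y′ in ey
... | true | true = cong₂ _+_ (≡ᵇ⇒≡ x x′ (Equivalence.from T-≡ ex)) (≡ᵇ⇒≡ y y′ (Equivalence.from T-≡ ey))

level≢⇒==ₚ-false : ∀ p q → level p ≢ level q → (p ==ₚ q) ≡ false
level≢⇒==ₚ-false p q ≢ with p ==ₚ q in eq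
... | true  = contradiction (==ₚ⇒level≡ p q eq) ≢
... | false = refl

memberₚ-below : ∀ β q p → level p < level q → memberₚ p (pointsFrom q β) ≡ false
memberₚ-below []      q p p<q = cong (_∨ false) (level≢⇒==ₚ-false p q (<⇒≢ p<q))
memberₚ-below (s ∷ β) q p p<q = cong₂ _∨_ (level≢⇒==ₚ-false p q (<⇒≢ p<q))
  (memberₚ-below β (move q s) p (subst (level p <_) (sym (level-move q s)) (m<n⇒m<1+n p<q)))

memberₚ-level : ∀ β q p → level p ≡ level q → (p ==ₚ q) ≡ false → memberₚ p (pointsFrom q β) ≡ false
memberₚ-level []      q p _   p≠q = cong (_∨ false) p≠q
memberₚ-level (s ∷ β) q p p~q p≠q = cong₂ _∨_ p≠q
  (memberₚ-below β (move q s) p (subst (level p <_) (sym (level-move q s)) (≤-reflexive (cong suc p~q))))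

memberₚ-head : ∀ β q p → (p ==ₚ q) ≡ true → memberₚ p (pointsFrom q β) ≡ true
memberₚ-head []      q p p=q = cong (_∨ false) p=q
memberₚ-head (s ∷ β) q p p=q = cong (_∨ memberₚ p (pointsFrom (move q s) β)) p=q

allᵇ-head : ∀ α q (f : Point → Bool) → f q ≡ false → allᵇ f (pointsFrom q α) ≡ false
allᵇ-head []      q f fq = cong (_∧ true) fq
allᵇ-head (s ∷ α) q f fq = cong (_∧ allᵇ f (pointsFrom (move q s) α)) fq

allᵇ-pointsFrom-cong : ∀ α q (f g : Point → Bool) → (∀ p → level q ≤ level p → f p ≡ g p) →
  allᵇ f (pointsFrom q α) ≡ allᵇ g (pointsFrom q α)
allᵇ-pointsFrom-cong []      q f g f≡g = cong (_∧ true) (f≡g q ≤-refl)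
allᵇ-pointsFrom-cong (s ∷ α) q f g f≡g = cong₂ _∧_ (f≡g q ≤-refl)
  (allᵇ-pointsFrom-cong α (move q s) f g
     (λ p q′≤p → f≡g p (≤-trans (n≤1+n _) (subst (_≤ level p) (level-move q s) q′≤p))))

endFrom-x : ∀ β x y → proj₁ (endFrom (x , y) β) ≡ x + #E β
endFrom-x []      x y = sym (+-identityʳ x)
endFrom-x (E ∷ β) x y = trans (endFrom-x β (suc x) y) (sym (+-suc x (#E β)))
endFrom-x (N ∷ β) x y = endFrom-x β x (suc y)

AtGap : ℕ → Point → Point → Set
AtGap h (x₁ , y₁) (x₂ , y₂) = (x₂ ≡ suc (x₁ + h)) × (y₁ ≡ suc (y₂ + h))

AtGap⇒level≡ : ∀ h q₁ q₂ → AtGap h q₁ q₂ → level q₁ ≡ level q₂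
AtGap⇒level≡ h (x₁ , _) (_ , y₂) (refl , refl) = shape x₁ y₂ h
  where
  shape : ∀ x y h → x + suc (y + h) ≡ suc (x + h) + y
  shape = solve-∀

AtGap⇒==ₚ-false : ∀ h q₁ q₂ → AtGap h q₁ q₂ → (q₁ ==ₚ q₂) ≡ false
AtGap⇒==ₚ-false h (x₁ , y₁) (x₂ , y₂) (refl , _) = cong (_∧ (y₁ ≡ᵇ y₂)) (≢⇒≡ᵇ-false (m≢1+m+n x₁))

gapStep-AtGap : ∀ h h′ a b q₁ q₂ → AtGap h q₁ q₂ → gapStep h a b ≡ just h′ → AtGap h′ (move q₁ a) (move q₂ b)
gapStep-AtGap h       _ N N (x₁ , y₁) (x₂ , y₂) (e₁ , e₂) refl = e₁ , cong suc e₂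
gapStep-AtGap h       _ N E (x₁ , y₁) (x₂ , y₂) (e₁ , e₂) refl =
  cong suc (trans e₁ (sym (+-suc x₁ h))) , cong suc (trans e₂ (sym (+-suc y₂ h)))
gapStep-AtGap h       _ E E (x₁ , y₁) (x₂ , y₂) (e₁ , e₂) refl = cong suc e₁ , e₂
gapStep-AtGap (suc h) _ E N (x₁ , y₁) (x₂ , y₂) (e₁ , e₂) refl =
  trans e₁ (cong suc (+-suc x₁ h)) , trans e₂ (cong suc (+-suc y₂ h))

avoids : Point → Point → Path → Path → Bool
avoids q₁ q₂ α β = allᵇ (λ p → not (memberₚ p (pointsFrom q₂ β))) (pointsFrom q₁ α)

xGapIs : ℤ → Point → Point → Path → Path → Bool
xGapIs δ q₁ q₂ α β = does ((+ proj₁ (endFrom q₂ β)) ℤ.- (+ proj₁ (endFrom q₁ α)) ℤ.≟ δ)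

endsAt : ℕ → Maybe ℕ → Bool
endsAt j = maybe′ (_≡ᵇ j) false

avoids-[] : ∀ h β q₁ q₂ → AtGap h q₁ q₂ → avoids q₁ q₂ [] β ≡ true
avoids-[] h β q₁ q₂ at =
  cong (λ b → not b ∧ true) (memberₚ-level β q₂ q₁ (AtGap⇒level≡ h q₁ q₂ at) (AtGap⇒==ₚ-false h q₁ q₂ at))

-- Points on different antidiagonals differ, so only the current points can meet.
avoids-∷ : ∀ h a b α β q₁ q₂ → AtGap h q₁ q₂ →
  avoids q₁ q₂ (a ∷ α) (b ∷ β) ≡ avoids (move q₁ a) (move q₂ b) α β
avoids-∷ h a b α β q₁ q₂ at = cong₂ _∧_ head rest
  where
  q₁~q₂ = AtGap⇒level≡ h q₁ q₂ at
  head : not ((q₁ ==ₚ q₂) ∨ memberₚ q₁ (pointsFrom (move q₂ b) β)) ≡ true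
  head = cong not (cong₂ _∨_ (AtGap⇒==ₚ-false h q₁ q₂ at)
    (memberₚ-below β (move q₂ b) q₁ (subst (level q₁ <_) (sym (level-move q₂ b)) (≤-reflexive (cong suc q₁~q₂)))))
  rest = allᵇ-pointsFrom-cong α (move q₁ a) _ _ (λ p q₁′≤p →
    cong (λ c → not (c ∨ memberₚ p (pointsFrom (move q₂ b) β)))
      (level≢⇒==ₚ-false p q₂ (λ p~q₂ → <-irrefl (sym (trans p~q₂ (sym q₁~q₂)))
                                                 (subst (_≤ level p) (level-move q₁ a) q₁′≤p))))

xGapIs-[] : ∀ j h β x₁ y₁ y₂ → xGapIs (+ suc j) (x₁ , y₁) (suc (x₁ + h) , y₂) [] β ≡ endsAt j (gapWalk h [] β)
xGapIs-[] j h β x₁ y₁ y₂ = begin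
  xGapIs (+ suc j) (x₁ , y₁) (suc (x₁ + h) , y₂) [] β ≡⟨ cong (λ z → does (z ℤ.≟ + suc j)) xGap ⟩
  (h + #E β ≡ᵇ j)                                     ≡⟨ cong (endsAt j) (gapWalk-padded h β) ⟨
  endsAt j (gapWalk h [] β)                           ∎
  where
  shape : ∀ x h e → suc (x + h) + e ≡ x + suc (h + e)
  shape = solve-∀
  xGap : + proj₁ (endFrom (suc (x₁ + h) , y₂) β) ℤ.- + x₁ ≡ + suc (h + #E β)
  xGap = begin
    + proj₁ (endFrom (suc (x₁ + h) , y₂) β) ℤ.- + x₁ ≡⟨ cong (λ x → + x ℤ.- + x₁) (endFrom-x β _ y₂) ⟩
    + (suc (x₁ + h) + #E β) ℤ.- + x₁               ≡⟨ cong (λ x → + x ℤ.- + x₁) (shape x₁ h (#E β)) ⟩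
    + (x₁ + suc (h + #E β)) ℤ.- + x₁               ≡⟨ [+m]-[+n]≡m⊖n _ x₁ ⟩
    (x₁ + suc (h + #E β)) ⊖ x₁                    ≡⟨ ⊖-≥ (m≤m+n x₁ _) ⟩
    + (x₁ + suc (h + #E β) ∸ x₁)                  ≡⟨ cong +_ (m+n∸m≡n x₁ _) ⟩
    + suc (h + #E β)                              ∎

AtGap-zero-collide : ∀ q₁ q₂ → AtGap 0 q₁ q₂ → (move q₁ E ==ₚ move q₂ N) ≡ true
AtGap-zero-collide (x₁ , y₁) (x₂ , y₂) (e₁ , e₂) =
  cong₂ _∧_ (≡⇒≡ᵇ-true (trans (cong suc (sym (+-identityʳ x₁))) (sym e₁)))
            (≡⇒≡ᵇ-true (trans e₂ (cong suc (+-identityʳ y₂))))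

lockstep : ∀ j α β h q₁ q₂ → length α ≤ length β → AtGap h q₁ q₂ →
  avoids q₁ q₂ α β ∧ xGapIs (+ suc j) q₁ q₂ α β ≡ endsAt j (gapWalk h α β)
lockstep j []      β       h q₁@(x₁ , y₁) q₂@(_ , y₂) _ at@(refl , _) =
  cong₂ _∧_ (avoids-[] h β q₁ q₂ at) (xGapIs-[] j h β x₁ y₁ y₂)
lockstep j (a ∷ α) (b ∷ β) h q₁ q₂ (s≤s le) at =
  trans (cong (_∧ xGapIs (+ suc j) (move q₁ a) (move q₂ b) α β) (avoids-∷ h a b α β q₁ q₂ at)) (moved a b h at)
  where
  moved : ∀ a b h → AtGap h q₁ q₂ →
    avoids (move q₁ a) (move q₂ b) α β ∧ xGapIs (+ suc j) (move q₁ a) (move q₂ b) α β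
      ≡ endsAt j (gapWalk h (a ∷ α) (b ∷ β))
  moved N N h       at = lockstep j α β h       _ _ le (gapStep-AtGap h       h       N N q₁ q₂ at refl)
  moved N E h       at = lockstep j α β (suc h) _ _ le (gapStep-AtGap h       (suc h) N E q₁ q₂ at refl)
  moved E E h       at = lockstep j α β h       _ _ le (gapStep-AtGap h       h       E E q₁ q₂ at refl)
  moved E N (suc h) at = lockstep j α β h       _ _ le (gapStep-AtGap (suc h) h       E N q₁ q₂ at refl)
  moved E N zero    at = cong (_∧ xGapIs (+ suc j) (move q₁ E) (move q₂ N) α β)
    (allᵇ-head α (move q₁ E) _ (cong not (memberₚ-head β (move q₂ N) (move q₁ E) (AtGap-zero-collide q₁ q₂ at))))

onlyOriginCommon-N∷-E∷ : ∀ α β → onlyOriginCommon (N ∷ α) (E ∷ β) ≡ avoids (0 , 1) (1 , 0) α β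
onlyOriginCommon-N∷-E∷ α β = allᵇ-pointsFrom-cong α (0 , 1) _ _ awayFromOrigin
  where
  awayFromOrigin : ∀ p → 1 ≤ level p →
    ((p ==ₚ (0 , 0)) ∨ not ((p ==ₚ (0 , 0)) ∨ memberₚ p (pointsFrom (1 , 0) β)))
      ≡ not (memberₚ p (pointsFrom (1 , 0) β))
  awayFromOrigin p 1≤p = cong (λ c → c ∨ not (c ∨ memberₚ p (pointsFrom (1 , 0) β)))
                              (level≢⇒==ₚ-false p (0 , 0) (λ p~0 → <-irrefl (sym p~0) 1≤p))

module _ (R : ℕ) where

  private
    K : ℕ
    K = suc R

  runOK : ℕ → Bool
  runOK b = congruentᵇ b R K

  ∣∣c-R∣⇔∣1+c : ∀ c → (K ∣ ∣ + c ℤ.- + R ∣) ⇔ (K ∣ suc c)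
  ∣∣c-R∣⇔∣1+c c with R ≤? c
  ... | yes R≤c = mk⇔ (λ d → subst (K ∣_) (sym 1+c) (∣m∣n⇒∣m+n n∣n (subst (K ∣_) ∣c-R∣ d)))
                      (λ d → subst (K ∣_) (sym ∣c-R∣) (∣m+n∣m⇒∣n (subst (K ∣_) 1+c d) n∣n))
    where
    ∣c-R∣ : ∣ + c ℤ.- + R ∣ ≡ c ∸ R
    ∣c-R∣ = cong ∣_∣ (trans ([+m]-[+n]≡m⊖n c R) (⊖-≥ R≤c))
    1+c : suc c ≡ K + (c ∸ R)
    1+c = cong suc (sym (m+[n∸m]≡n R≤c))
  ... | no R≰c = mk⇔ (λ d → contradiction (subst (K ∣_) ∣c-R∣ d) (>⇒∤ {{R-c≢0}} (s≤s (m∸n≤m R c))))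
                     (λ d → contradiction d (>⇒∤ (s≤s c<R)))
    where
    c<R = ≰⇒> R≰c
    ∣c-R∣ : ∣ + c ℤ.- + R ∣ ≡ R ∸ c
    ∣c-R∣ = trans (cong ∣_∣ ([+m]-[+n]≡m⊖n c R)) (∣⊖∣-< c<R)
    R-c≢0 : NonZero (R ∸ c)
    R-c≢0 = ≢-nonZero (m>n⇒m∸n≢0 c<R)

  ∣1+c⇔phase≡0 : ∀ r c → r ≤ R → K ∣ suc (r + c) → (K ∣ suc c) ⇔ (r ≡ 0)
  ∣1+c⇔phase≡0 zero    c _   K∣ = mk⇔ (λ _ → refl) (λ _ → K∣)
  ∣1+c⇔phase≡0 (suc r) c r≤R K∣ = mk⇔ (λ d → contradiction (∣m+n∣m⇒∣n K∣′ d) (>⇒∤ (s≤s r≤R))) (λ ())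
    where
    K∣′ : K ∣ suc c + suc r
    K∣′ = subst (K ∣_) (cong suc (+-comm (suc r) c)) K∣

  runOK-phase : ∀ r c → r ≤ R → K ∣ suc (r + c) → runOK c ≡ (r ≡ᵇ 0)
  runOK-phase r c r≤R K∣ =
    trans (does-⇔ (∣∣c-R∣⇔∣1+c c) (K ∣? _) (K ∣? suc c))
          (does-⇔ (∣1+c⇔phase≡0 r c r≤R K∣) (K ∣? suc c) (r ≟ 0))

  -- c is the length of the N-run of γ₂ read so far.
  phaseOK-runs : ∀ β r c → r ≤ R → K ∣ suc (r + c) →
    phaseOK R r β ∧ (phase R r (length β) ≡ᵇ 0) ≡ runOK (c + proj₁ (runs β)) ∧ allᵇ runOK (proj₂ (runs β))
  phaseOK-runs []      r       c r≤R K∣ =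
    sym (trans (∧-identityʳ _) (trans (cong runOK (+-identityʳ c)) (runOK-phase r c r≤R K∣)))
  phaseOK-runs (N ∷ β) zero    c _   K∣ =
    trans (phaseOK-runs β R (suc c) ≤-refl (∣m∣n⇒∣m+n n∣n K∣))
          (cong (λ b → runOK b ∧ allᵇ runOK (proj₂ (runs β))) (sym (+-suc c _)))
  phaseOK-runs (N ∷ β) (suc r) c r≤R K∣ =
    trans (phaseOK-runs β r (suc c) (≤-trans (n≤1+n r) r≤R) (subst (K ∣_) (cong suc (sym (+-suc r c))) K∣))
          (cong (λ b → runOK b ∧ allᵇ runOK (proj₂ (runs β))) (sym (+-suc c _)))
  phaseOK-runs (E ∷ β) zero    c _   K∣ =
    trans (phaseOK-runs β R 0 ≤-refl (subst (K ∣_) (cong suc (sym (+-identityʳ R))) n∣n))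
          (sym (cong (_∧ (runOK (proj₁ (runs β)) ∧ allᵇ runOK (proj₂ (runs β))))
                     (trans (cong runOK (+-identityʳ c)) (runOK-phase 0 c z≤n K∣))))
  phaseOK-runs (E ∷ β) (suc r) c r≤R K∣ =
    sym (cong (_∧ (runOK (proj₁ (runs β)) ∧ allᵇ runOK (proj₂ (runs β))))
              (trans (cong runOK (+-identityʳ c)) (runOK-phase (suc r) c r≤R K∣)))

  blocksOK-E∷ : ∀ β → blocksOK (suc K) (E ∷ β) ≡ phaseOK R R β ∧ (phase R R (length β) ≡ᵇ 0)
  blocksOK-E∷ β = sym (phaseOK-runs β R 0 ≤-refl (subst (K ∣_) (cong suc (sym (+-identityʳ R))) n∣n))

-- Counting

𝟙-endsAt-∧ : ∀ j (m : Maybe ℕ) b → 𝟙 (endsAt j m ∧ b) ≡ maybe′ 𝟙[≡ j ] 0 (if b then m else nothing)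
𝟙-endsAt-∧ j (just h) true  = cong 𝟙 (∧-identityʳ (h ≡ᵇ j))
𝟙-endsAt-∧ j (just h) false = cong 𝟙 (∧-zeroʳ (h ≡ᵇ j))
𝟙-endsAt-∧ j nothing  true  = refl
𝟙-endsAt-∧ j nothing  false = refl

module _ (R : ℕ) where

  private
    K k : ℕ
    K = suc R
    k = suc K

  𝟙-gap∧blocksOK : ∀ j α β b → b ≡ endsAt j (gapWalk 0 α β) → phase R R (length β) ≡ 0 →
    𝟙 (b ∧ blocksOK k (E ∷ β)) ≡ maybe′ 𝟙[≡ j ] 0 (walk R R 0 α β)
  𝟙-gap∧blocksOK j α β b b≡ blockEnd = begin
    𝟙 (b ∧ blocksOK k (E ∷ β))
      ≡⟨ cong₂ (λ a c → 𝟙 (a ∧ c)) b≡ (blocksOK-E∷ R β) ⟩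
    𝟙 (endsAt j (gapWalk 0 α β) ∧ (phaseOK R R β ∧ (phase R R (length β) ≡ᵇ 0)))
      ≡⟨ cong (λ c → 𝟙 (endsAt j (gapWalk 0 α β) ∧ c))
              (trans (cong (phaseOK R R β ∧_) (≡⇒≡ᵇ-true blockEnd)) (∧-identityʳ _)) ⟩
    𝟙 (endsAt j (gapWalk 0 α β) ∧ phaseOK R R β)
      ≡⟨ 𝟙-endsAt-∧ j (gapWalk 0 α β) (phaseOK R R β) ⟩
    maybe′ 𝟙[≡ j ] 0 (walk R R 0 α β) ∎

  module _ (ε n : ℕ) where

    inP-E∷ : ∀ δ α γ₂ → inP k ε n δ (E ∷ α) γ₂ ≡ false
    inP-E∷ δ α γ₂ = trans (cong (λ b → first ∧ (b ∧ rest)) (∧-zeroʳ (suc (length α) ≡ᵇ K * n ∸ ε))) (∧-zeroʳ first)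
      where
      first = (length γ₂ ≡ᵇ K * n) ∧ startsWithE γ₂
      rest = onlyOriginCommon (E ∷ α) γ₂ ∧ does (xDiff (E ∷ α) γ₂ ℤ.≟ δ) ∧ blocksOK k γ₂

    inP-∷N : ∀ δ γ₁ β → inP k ε n δ γ₁ (N ∷ β) ≡ false
    inP-∷N δ γ₁ β = cong (_∧ rest) (∧-zeroʳ (suc (length β) ≡ᵇ K * n))
      where
      rest = ((length γ₁ ≡ᵇ K * n ∸ ε) ∧ startsWithNIfNonempty γ₁) ∧ onlyOriginCommon γ₁ (N ∷ β)
             ∧ does (xDiff γ₁ (N ∷ β) ℤ.≟ δ) ∧ blocksOK k (N ∷ β)

    inP-N∷-E∷ : ∀ j α β → length α ≤ length β → suc (length β) ≡ K * n → suc (length α) ≡ K * n ∸ ε →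
      phase R R (length β) ≡ 0 → 𝟙 (inP k ε n (+ suc j) (N ∷ α) (E ∷ β)) ≡ maybe′ 𝟙[≡ j ] 0 (walk R R 0 α β)
    inP-N∷-E∷ j α β |α|≤|β| |γ₂| |γ₁| blockEnd = begin
      𝟙 (inP k ε n (+ suc j) (N ∷ α) (E ∷ β))
        ≡⟨ cong₂ (λ a b → 𝟙 ((a ∧ true) ∧ (b ∧ true) ∧ onlyOriginCommon (N ∷ α) (E ∷ β) ∧ xGap ∧ blocksOK k (E ∷ β)))
                 (≡⇒≡ᵇ-true |γ₂|) (≡⇒≡ᵇ-true |γ₁|) ⟩
      𝟙 (onlyOriginCommon (N ∷ α) (E ∷ β) ∧ xGap ∧ blocksOK k (E ∷ β))
        ≡⟨ cong (λ a → 𝟙 (a ∧ xGap ∧ blocksOK k (E ∷ β))) (onlyOriginCommon-N∷-E∷ α β) ⟩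
      𝟙 (avoids (0 , 1) (1 , 0) α β ∧ xGap ∧ blocksOK k (E ∷ β))
        ≡⟨ cong 𝟙 (∧-assoc (avoids (0 , 1) (1 , 0) α β) xGap _) ⟨
      𝟙 ((avoids (0 , 1) (1 , 0) α β ∧ xGap) ∧ blocksOK k (E ∷ β))
        ≡⟨ 𝟙-gap∧blocksOK j α β _ (lockstep j α β 0 (0 , 1) (1 , 0) |α|≤|β| (refl , refl)) blockEnd ⟩
      maybe′ 𝟙[≡ j ] 0 (walk R R 0 α β) ∎
      where
      xGap = xGapIs (+ suc j) (0 , 1) (1 , 0) α β

    inP-[]-E∷ : ∀ j β → suc (length β) ≡ K * n → 0 ≡ K * n ∸ ε → phase R R (length β) ≡ 0 →
      𝟙 (inP k ε n (+ suc j) [] (E ∷ β)) ≡ maybe′ 𝟙[≡ j ] 0 (walk R R 0 [] β)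
    inP-[]-E∷ j β |γ₂| |γ₁| blockEnd = begin
      𝟙 (inP k ε n (+ suc j) [] (E ∷ β))
        ≡⟨ cong₂ (λ a b → 𝟙 ((a ∧ true) ∧ (b ∧ true) ∧ true ∧ xGap ∧ blocksOK k (E ∷ β)))
                 (≡⇒≡ᵇ-true |γ₂|) (≡⇒≡ᵇ-true |γ₁|) ⟩
      𝟙 (xGap ∧ blocksOK k (E ∷ β))
        ≡⟨ 𝟙-gap∧blocksOK j [] β xGap (xGapIs-[] j 0 β 0 0 0) blockEnd ⟩
      maybe′ 𝟙[≡ j ] 0 (walk R R 0 [] β) ∎
      where
      xGap = xGapIs (+ suc j) (0 , 0) (1 , 0) [] β

  cardP-as-walkSum : ∀ ε i j ℓ r → K * suc i ∸ ε ≡ suc ℓ → K * suc i ≡ suc (ℓ + ε) → phase R R ℓ ≡ r →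
    cardP k ε (suc i) (+ suc j) ≡ walkSum R ℓ (λ h → ∑[ β ← allPaths ε ] maybe′ 𝟙[≡ j ] 0 (walk R r h [] β))
  cardP-as-walkSum ε i j ℓ r |γ₁| |γ₂| tailPhase = begin
    cardP k ε n δ
      ≡⟨ length-filterᵇ-pairs (λ γ → inP k ε n δ (proj₁ γ) (proj₂ γ)) (allPaths (K * n ∸ ε)) (allPaths (K * n)) ⟩
    ∑[ γ₁ ← allPaths (K * n ∸ ε) ] ∑[ γ₂ ← allPaths (K * n) ] 𝟙 (inP k ε n δ γ₁ γ₂)
      ≡⟨ cong₂ (λ a b → ∑[ γ₁ ← allPaths a ] ∑[ γ₂ ← allPaths b ] 𝟙 (inP k ε n δ γ₁ γ₂)) |γ₁| |γ₂| ⟩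
    ∑[ γ₁ ← allPaths (suc ℓ) ] ∑[ γ₂ ← allPaths (suc (ℓ + ε)) ] 𝟙 (inP k ε n δ γ₁ γ₂)
      ≡⟨ ∑-allPaths-N∷ ℓ _ (λ α → ∑-vanishes (allPaths (suc (ℓ + ε))) (λ γ₂ → cong 𝟙 (inP-E∷ ε n δ α γ₂))) ⟩
    ∑[ α ← allPaths ℓ ] ∑[ γ₂ ← allPaths (suc (ℓ + ε)) ] 𝟙 (inP k ε n δ (N ∷ α) γ₂)
      ≡⟨ ∑-cong (allPaths ℓ) (λ α → ∑-allPaths-E∷ (ℓ + ε) _ (λ β → cong 𝟙 (inP-∷N ε n δ (N ∷ α) β))) ⟩
    ∑[ α ← allPaths ℓ ] ∑[ β ← allPaths (ℓ + ε) ] 𝟙 (inP k ε n δ (N ∷ α) (E ∷ β))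
      ≡⟨ ∑-allPaths-cong ℓ (λ α |α| → ∑-allPaths-cong (ℓ + ε) (λ β |β| → weight α β |α| |β|)) ⟩
    ∑[ α ← allPaths ℓ ] ∑[ β ← allPaths (ℓ + ε) ] w α β
      ≡⟨ ∑-cong (allPaths ℓ) (λ α → trans (∑-allPaths-+ ℓ ε (w α)) (∑-cong (allPaths ℓ) (λ β → pad α β))) ⟩
    ∑[ α ← allPaths ℓ ] ∑[ β ← allPaths ℓ ] ∑[ α′ ← allPaths 0 ] ∑[ β′ ← allPaths ε ] w (α ++ α′) (β ++ β′)
      ≡⟨ walkSum-extend R ℓ 0 ε 𝟙[≡ j ] ⟩
    walkSum R ℓ (λ h → ∑[ α′ ← allPaths 0 ] ∑[ β′ ← allPaths ε ] maybe′ 𝟙[≡ j ] 0 (walk R (phase R R ℓ) h α′ β′))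
      ≡⟨ walkSum-cong R ℓ (λ h → trans (+-identityʳ _)
           (cong (λ r′ → ∑[ β ← allPaths ε ] maybe′ 𝟙[≡ j ] 0 (walk R r′ h [] β)) tailPhase)) ⟩
    walkSum R ℓ (λ h → ∑[ β ← allPaths ε ] maybe′ 𝟙[≡ j ] 0 (walk R r h [] β)) ∎
    where
    n = suc i
    δ = + suc j
    w : Path → Path → ℕ
    w α β = maybe′ 𝟙[≡ j ] 0 (walk R R 0 α β)
    weight : ∀ α β → length α ≡ ℓ → length β ≡ ℓ + ε → 𝟙 (inP k ε n δ (N ∷ α) (E ∷ β)) ≡ w α β
    weight α β |α| |β| = inP-N∷-E∷ ε n j α β
      (subst₂ _≤_ (sym |α|) (sym |β|) (m≤m+n ℓ ε))
      (trans (cong suc |β|) (sym |γ₂|)) (trans (cong suc |α|) (sym |γ₁|))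
      (phase-blockEnd R i (length β) (trans (cong suc |β|) (sym |γ₂|)))
    pad : ∀ α β → ∑[ β′ ← allPaths ε ] w α (β ++ β′) ≡ ∑[ α′ ← allPaths 0 ] ∑[ β′ ← allPaths ε ] w (α ++ α′) (β ++ β′)
    pad α β = sym (trans (+-identityʳ _) (cong (λ a → ∑[ β′ ← allPaths ε ] w a (β ++ β′)) (++-identityʳ α)))

  cardP-ε≤R : ∀ ε i j → ε ≤ R → cardP k ε (suc i) (+ suc j) ≡ shift j (raney k (k ∸ ε + k * j)) i
  cardP-ε≤R ε i j ε≤R = begin
    cardP k ε (suc i) (+ suc j)
      ≡⟨ cardP-as-walkSum ε i j ℓ ε (trans (cong (_∸ ε) lengths) (m+n∸n≡m (suc ℓ) ε)) lengths tailPhase ⟩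
    walkSum R ℓ (λ h → ∑[ β ← allPaths ε ] maybe′ 𝟙[≡ j ] 0 (walk R ε h [] β))
      ≡⟨ walkSum-cong R ℓ (λ h → ∑-padded-walk R ε h 𝟙[≡ j ]) ⟩
    walks R ℓ j
      ≡⟨ walks-closed R i q (m∸n≤m R ε) j ⟩
    shift j (raney k (2 + q + k * j)) i
      ≡⟨ cong (λ r → shift j (raney k (r + k * j)) i) (+-∸-assoc 2 ε≤R) ⟨
    shift j (raney k (k ∸ ε + k * j)) i ∎
    where
    q = R ∸ ε
    ℓ = K * i + q
    lengths : K * suc i ≡ suc (ℓ + ε)
    lengths = begin
      K * suc i             ≡⟨ *-suc K i ⟩
      suc (R + K * i)       ≡⟨ cong suc (+-comm R (K * i)) ⟩
      suc (K * i + R)       ≡⟨ cong (λ r → suc (K * i + r)) (m∸n+n≡m ε≤R) ⟨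
      suc (K * i + (q + ε)) ≡⟨ cong suc (+-assoc (K * i) q ε) ⟨
      suc (ℓ + ε)           ∎
    tailPhase : phase R R ℓ ≡ ε
    tailPhase = trans (phase-periodic-+ R i q (m∸n≤m R ε)) (m∸[m∸n]≡n ε≤R)

  cardP-ε≡K : ∀ i j → cardP k K (suc (suc i)) (+ suc j) ≡ shift j (raney k (k ∸ K + k * j)) (suc i)
  cardP-ε≡K i j = begin
    cardP k K (suc (suc i)) (+ suc j)
      ≡⟨ cardP-as-walkSum K (suc i) j ℓ 0 (trans (cong (_∸ K) lengths) (m+n∸n≡m (suc ℓ) K)) lengths tailPhase ⟩
    walkSum R ℓ (λ h → ∑[ β ← allPaths K ] maybe′ 𝟙[≡ j ] 0 (walk R 0 h [] β))
      ≡⟨ walkSum-cong R ℓ (λ h → ∑-padded-walk-block R h 𝟙[≡ j ]) ⟩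
    walkSum R ℓ (λ h → 𝟙[≡ j ] (suc h) + 𝟙[≡ j ] h)
      ≡⟨ walkSum-+ R ℓ (λ h → 𝟙[≡ j ] (suc h)) 𝟙[≡ j ] ⟩
    walkSum R ℓ (λ h → 𝟙[≡ j ] (suc h)) + walks R ℓ j
      ≡⟨ cong₂ _+_ (trans (walkSum-𝟙[≡suc] R ℓ j) (walks⁻-closed-blockEnd R i (walks-closed R i R ≤-refl) j))
                   (walks-closed R i R ≤-refl j) ⟩
    shift j (raney k (k * j)) (suc i) + shift (suc j) (raney k (k + k * j)) (suc i)
      ≡⟨ shift-raney-suc k j (k * j) (suc i) ⟨
    shift j (raney k (suc (k * j))) (suc i)
      ≡⟨ cong (λ r → shift j (raney k (r + k * j)) (suc i)) (m+n∸n≡m 1 R) ⟨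
    shift j (raney k (k ∸ K + k * j)) (suc i) ∎
    where
    ℓ = K * i + R
    lengths : K * suc (suc i) ≡ suc (ℓ + K)
    lengths = begin
      K * suc (suc i)       ≡⟨ *-suc K (suc i) ⟩
      K + K * suc i         ≡⟨ cong (_+_ K) (*-suc K i) ⟩
      K + (K + K * i)       ≡⟨ shape K R (K * i) ⟩
      suc (K * i + R + K)   ∎
      where
      shape : ∀ K R y → suc R + (K + y) ≡ suc (y + R + K)
      shape = solve-∀
    tailPhase : phase R R ℓ ≡ 0
    tailPhase = trans (phase-periodic-+ R i R ≤-refl) (n∸n≡0 R)

  cardP-ε≡K-n≡1 : ∀ j → cardP k K 1 (+ suc j) ≡ shift j (raney k (k ∸ K + k * j)) 0
  cardP-ε≡K-n≡1 j = begin
    cardP k K 1 δ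
      ≡⟨ length-filterᵇ-pairs (λ γ → inP k K 1 δ (proj₁ γ) (proj₂ γ)) (allPaths (K * 1 ∸ K)) (allPaths (K * 1)) ⟩
    ∑[ γ₁ ← allPaths (K * 1 ∸ K) ] ∑[ γ₂ ← allPaths (K * 1) ] 𝟙 (inP k K 1 δ γ₁ γ₂)
      ≡⟨ cong₂ (λ a b → ∑[ γ₁ ← allPaths a ] ∑[ γ₂ ← allPaths b ] 𝟙 (inP k K 1 δ γ₁ γ₂)) |γ₁| (*-identityʳ K) ⟩
    ∑[ γ₂ ← allPaths K ] 𝟙 (inP k K 1 δ [] γ₂) + 0
      ≡⟨ +-identityʳ _ ⟩
    ∑[ γ₂ ← allPaths K ] 𝟙 (inP k K 1 δ [] γ₂)
      ≡⟨ ∑-allPaths-E∷ R _ (λ β → cong 𝟙 (inP-∷N K 1 δ [] β)) ⟩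
    ∑[ β ← allPaths R ] 𝟙 (inP k K 1 δ [] (E ∷ β))
      ≡⟨ ∑-allPaths-cong R (λ β |β| →
           inP-[]-E∷ K 1 j β (|γ₂| β |β|) (sym |γ₁|) (phase-blockEnd R 0 (length β) (|γ₂| β |β|))) ⟩
    ∑[ β ← allPaths R ] maybe′ 𝟙[≡ j ] 0 (walk R R 0 [] β)
      ≡⟨ ∑-padded-walk R R 0 𝟙[≡ j ] ⟩
    𝟙[≡ j ] 0
      ≡⟨ atOrigin j ⟩
    shift j (raney k (k ∸ K + k * j)) 0 ∎
    where
    δ = + suc j
    |γ₁| : K * 1 ∸ K ≡ 0
    |γ₁| = trans (cong (_∸ K) (*-identityʳ K)) (n∸n≡0 K)
    |γ₂| : ∀ β → length β ≡ R → suc (length β) ≡ K * 1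
    |γ₂| β |β| = trans (cong suc |β|) (sym (*-identityʳ K))
    atOrigin : ∀ j → 𝟙[≡ j ] 0 ≡ shift j (raney k (k ∸ K + k * j)) 0
    atOrigin zero    = sym (raney-zero k (k ∸ K + k * 0))
    atOrigin (suc j) = refl

  cardP≡raney : ∀ ε → ε ≤ K → ∀ i j → cardP k ε (suc i) (+ suc j) ≡ shift j (raney k (k ∸ ε + k * j)) i
  cardP≡raney ε ε≤K i j with ε ≤? R
  ... | yes ε≤R = cardP-ε≤R ε i j ε≤R
  ... | no  ε≰R with ≤-antisym ε≤K (≰⇒> ε≰R)
  ...   | refl with i
  ...     | zero   = cardP-ε≡K-n≡1 j
  ...     | suc i′ = cardP-ε≡K i′ j

theorem2p2 : (k ε : ℕ) → 2 ≤ k → ε ≤ k ∸ 1 → (i j : ℕ) →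
    cardP k ε (suc i) (+ suc j)
      ≡ riordanEntry (Cgf k ^ₚ (k ∸ ε)) (tTimes (Cgf k ^ₚ k)) i j
theorem2p2 k@(suc (suc R)) ε (s≤s (s≤s z≤n)) ε≤k-1 i j =
  trans (cardP≡raney R ε ε≤k-1 i j) (sym (riordanEntry-Cgf k (k ∸ ε) i j))
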